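{- Fix integers $t\geq 1$, $C_1,\dots,C_t\geq 1$, and $A_1,\dots,A_t$ with $0\leq A_i\leq C_i/2$ for all $i=1,\dots,t$. Let $S$ be the multiset which, for each $i$, contains one copy of the positive integers congruent to $A_i$ modulo $C_i$ and one separate copy of the positive integers congruent to $-A_i$ modulo $C_i$. Let $D_S(N)$ be the number of partitions of $N$ into distinct elements of $S$ (elements coming from different copies count as distinct), where, if no $A_i$ is equal to zero, such partitions are additionally required to have an odd number of parts. Set $r=|\{i: A_i=0\}|-1$, with the convention that $|\{i:A_i=0\}|$ is taken to be $1$ if no $A_i$ equals $0$. Then, for all integers $N\geq 1$, $2^{r}\cdot D_S(N)$ equals the number of tuples $(\nu_1,\dots,\nu_{t};d_1,\dots,d_{t})$ with $\nu_i\in P$ and $d_i\in\mathbb Z$ for all $i$, $\sum_{i=1}^t d_i$ odd, and $$\sum_{i=1}^{t}C_i|\nu_i|+\sum_{i=1}^{t}C_i\binom{d_i}{2}+\sum_{i=1}^{t}A_{i}d_{i}=N.$$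
   Context: $P$ denotes the set of all integer partitions into positive parts (including the empty partition, which is the unique partition of $0$); for a partition $\nu$, $|\nu|$ is the sum of its parts. For any $d\in\mathbb Z$, $\binom{d}{2}=d(d-1)/2$. -}

module Defs where

open import Data.Nat as ℕ using (ℕ; zero; suc; _≤_; _≥_; _>_; _%_; _/_)
open import Data.Nat.ListAction using (sum)
open import Data.Integer as ℤ using (ℤ; +_; -[1+_]; ∣_∣)
open import Data.Integer.Divisibility using (_∣_)
open import Data.Fin using (Fin; zero; suc)
open import Data.List using (List; length; filter)
open import Data.List.Relation.Unary.All using (All)
open import Data.List.Relation.Unary.Linked using (Linked)
open import Data.Vec using (Vec; lookup)
open import Data.Product using (Σ; _×_; proj₁; proj₂)
open import Data.Unit using (⊤)
open import Relation.Binary.PropositionalEquality using (_≡_)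

AllFin : (t : ℕ) → (Fin t → Set) → Set
AllFin zero    P = ⊤
AllFin (suc t) P = P zero × AllFin t (λ i → P (suc i))

sumFinℕ : (t : ℕ) → (Fin t → ℕ) → ℕ
sumFinℕ zero    f = 0
sumFinℕ (suc t) f = f zero ℕ.+ sumFinℕ t (λ i → f (suc i))

sumFinℤ : (t : ℕ) → (Fin t → ℤ) → ℤ
sumFinℤ zero    f = + 0
sumFinℤ (suc t) f = f zero ℤ.+ sumFinℤ t (λ i → f (suc i))

countZeros : (t : ℕ) → (Fin t → ℕ) → ℕ
countZeros zero    A = 0
countZeros (suc t) A with A zero
... | zero  = suc (countZeros t (λ i → A (suc i)))
... | suc _ = countZeros t (λ i → A (suc i))

IsPartition : List ℕ → Set
IsPartition l = All (λ x → 1 ≤ x) l × Linked _≥_ l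

Partition : Set
Partition = Σ (List ℕ) IsPartition

size : Partition → ℕ
size p = sum (proj₁ p)

binom2 : ℤ → ℤ
binom2 (+ n)     = + ((n ℕ.* (n ℕ.∸ 1)) / 2)
binom2 -[1+ k ]  = + ((suc k ℕ.* suc (suc k)) / 2)   -- d = -(k+1): d(d-1)/2 = (k+1)(k+2)/2

OddZ : ℤ → Set
OddZ z = ∣ z ∣ % 2 ≡ 1

InCopy : ℕ → ℤ → ℕ → Set
InCopy C a n = 1 ≤ n × (+ C) ∣ ((+ n) ℤ.- a)

DistinctSubset : ℕ → ℤ → List ℕ → Set
DistinctSubset C a l = Linked _>_ l × All (InCopy C a) l

-- If no A_i is zero (z = 0), the number of parts k must be odd.
ParityOK : ℕ → ℕ → Set
ParityOK zero    k = k % 2 ≡ 1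
ParityOK (suc _) k = ⊤

DistPart : (t : ℕ) → (C A : Fin t → ℕ) → ℕ → Set
DistPart t C A N =
  Σ (Vec (List ℕ × List ℕ) t) λ v →
    AllFin t (λ i → DistinctSubset (C i) (+ A i) (proj₁ (lookup v i))
                  × DistinctSubset (C i) (ℤ.- (+ A i)) (proj₂ (lookup v i)))
    × sumFinℕ t (λ i → sum (proj₁ (lookup v i)) ℕ.+ sum (proj₂ (lookup v i))) ≡ N
    × ParityOK (countZeros t A)
               (sumFinℕ t (λ i → length (proj₁ (lookup v i)) ℕ.+ length (proj₂ (lookup v i))))

Tuples : (t : ℕ) → (C A : Fin t → ℕ) → ℕ → Set
Tuples t C A N =
  Σ (Vec (Partition × ℤ) t) λ v →
    OddZ (sumFinℤ t (λ i → proj₂ (lookup v i)))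
    × (sumFinℤ t (λ i → (+ C i) ℤ.* (+ size (proj₁ (lookup v i))))
       ℤ.+ sumFinℤ t (λ i → (+ C i) ℤ.* binom2 (proj₂ (lookup v i)))
       ℤ.+ sumFinℤ t (λ i → (+ A i) ℤ.* proj₂ (lookup v i))) ≡ + N

module Submission where

-- The identity is proved bijectively, along the lines of
-- the Maya-diagram proof of Jacobi's triple product identity.
--  (1) A partition ν together with a charge d ∈ ℤ is the same as a Maya
--      diagram, recorded as a pair (P , Q) of finite subsets of ℕ
--      (particles at positive and holes at negative half-integer sites),
--      with charge |P| - |Q| = d and energy ΣP + ΣQ + |Q| = |ν| + binom2 d
--      (module JacobiTripleProduct: shift a charge-zero diagram by d).
--  (2) For one index i, the progressions j ↦ C j + A and j ↦ C j + (C - A)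
--      send P and Q to sets of distinct parts from the residue classes
--      ±A mod C, of total C·energy + A·charge.  For A = 0 a particle at ½
--      would be sent to 0, so it is recorded as a flag instead (Colours).
--  (3) Parts and flags number |P| + |Q| ≡ d (mod 2).  Flag vectors, with
--      flags allowed only where A i = 0, that complete a given number of
--      parts to an odd total come in 2^(z-1) choices when z ≥ 1, and when
--      z = 0 exist only if that number is already odd (FlagVectors).
-- Hence Tuples ↔ Fin 2^r × DistPart (Counting), and since DistPart is
-- finite (FiniteDistPart) the theorem follows with m = |DistPart|.

open import Defs
open import Data.Nat using (ℕ; _≤_; _*_; _^_; _∸_)
open import Data.Fin using (Fin)
open import Data.Product using (Σ; _×_)
open import Function.Bundles using (_↔_)
open import Relation.Binary.PropositionalEquality using (_≡_)

open import Data.Nat using (NonZero)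
open import Data.Product using (_,_; proj₁; proj₂)
open import Relation.Binary.PropositionalEquality
  using (refl; sym; trans; cong; cong₂; subst; module ≡-Reasoning)
import Data.Integer as ℤ
import Data.Integer.Divisibility.Signed as Signed

module Bijections where

  open import Data.Nat using (zero; suc; _+_; _*_)
  open import Data.Fin using (zero; suc)
  open import Function.Bundles using (Inverse; mk↔ₛ′)
  open import Data.Fin.Properties using (+↔⊎; *↔×)
  open import Data.Product.Function.NonDependent.Propositional using (_×-↔_)
  open import Data.Product.Function.Dependent.Propositional using (Σ-↔)
  open import Data.Sum using (_⊎_; inj₁; inj₂)
  open import Data.Sum.Function.Propositional using (_⊎-↔_)
  open import Data.Unit using (⊤; tt)
  open import Function.Properties.Inverse using (↔-refl; ↔-sym; ↔-trans)
  open import Relation.Nullary using (Dec; yes; no; Irrelevant; contradiction)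

  open Inverse public using (to; from)
    renaming (strictlyInverseˡ to to-from; strictlyInverseʳ to from-to)

  Σ-≡-irrelevant : ∀ {A : Set} {P : A → Set} → (∀ a → Irrelevant (P a)) →
                   {x y : Σ A P} → proj₁ x ≡ proj₁ y → x ≡ y
  Σ-≡-irrelevant irr {a , p} {.a , q} refl = cong (a ,_) (irr a p q)

  ×-irrelevant : ∀ {A B : Set} → Irrelevant A → Irrelevant B → Irrelevant (A × B)
  ×-irrelevant irrA irrB (a , b) (a′ , b′) = cong₂ _,_ (irrA a a′) (irrB b b′)

  Σ-cong-irrelevant : ∀ {A : Set} {P Q : A → Set} →
    (∀ a → P a → Q a) → (∀ a → Q a → P a) →
    (∀ a → Irrelevant (P a)) → (∀ a → Irrelevant (Q a)) → Σ A P ↔ Σ A Q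
  Σ-cong-irrelevant P⇒Q Q⇒P irrP irrQ =
    Σ-↔ ↔-refl (λ {a} → mk↔ₛ′ (P⇒Q a) (Q⇒P a) (λ q → irrQ a _ q) (λ p → irrP a _ p))

  Finite : Set → Set
  Finite X = Σ ℕ λ m → X ↔ Fin m

  finite-↔ : ∀ {A B : Set} → A ↔ B → Finite B → Finite A
  finite-↔ A↔B (m , B↔m) = m , ↔-trans A↔B B↔m

  finite-⊤ : Finite ⊤
  finite-⊤ = 1 , mk↔ₛ′ (λ _ → zero) (λ _ → tt) (λ { zero → refl }) (λ _ → refl)

  finite-⊎ : ∀ {A B : Set} → Finite A → Finite B → Finite (A ⊎ B)
  finite-⊎ (m , A↔m) (n , B↔n) = m + n , ↔-trans (A↔m ⊎-↔ B↔n) (↔-sym +↔⊎)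

  finite-× : ∀ {A B : Set} → Finite A → Finite B → Finite (A × B)
  finite-× (m , A↔m) (n , B↔n) = m * n , ↔-trans (A↔m ×-↔ B↔n) (↔-sym *↔×)

  finite-prop : ∀ {P : Set} → Dec P → Irrelevant P → Finite P
  finite-prop (yes p) irr = 1 , mk↔ₛ′ (λ _ → zero) (λ _ → p) (λ { zero → refl }) (irr p)
  finite-prop (no ¬p) irr = 0 , mk↔ₛ′ (λ p → contradiction p ¬p) (λ ()) (λ ()) (λ p → contradiction p ¬p)

  finite-ΣFin : ∀ n {P : Fin n → Set} → (∀ i → Finite (P i)) → Finite (Σ (Fin n) P)
  finite-ΣFin zero    fin = 0 , mk↔ₛ′ (λ { (() , _) }) (λ ()) (λ ()) (λ { (() , _) })
  finite-ΣFin (suc n) fin =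
    finite-↔ splitZero (finite-⊎ (fin zero) (finite-ΣFin n (λ i → fin (suc i))))
    where
    splitZero : ∀ {P : Fin (suc n) → Set} → Σ (Fin (suc n)) P ↔ (P zero ⊎ Σ (Fin n) (λ i → P (suc i)))
    splitZero = mk↔ₛ′ (λ { (zero , p) → inj₁ p ; (suc i , p) → inj₂ (i , p) })
                      (λ { (inj₁ p) → zero , p ; (inj₂ (i , p)) → suc i , p })
                      (λ { (inj₁ _) → refl ; (inj₂ _) → refl })
                      (λ { (zero , _) → refl ; (suc _ , _) → refl })

  finite-Σ : ∀ {A : Set} {P : A → Set} → Finite A → (∀ a → Finite (P a)) → Finite (Σ A P)
  finite-Σ (m , A↔m) fin =
    finite-↔ (↔-sym (Σ-↔ (↔-sym A↔m) ↔-refl)) (finite-ΣFin m (λ i → fin (from A↔m i)))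

module StrictLists where

  open import Data.Nat using (ℕ; zero; suc; _+_; _>_; s≤s; z≤n)
  open import Data.Nat.Properties using (<-irrelevant)
  open import Data.Nat.ListAction using (sum)
  open import Data.Nat.Tactic.RingSolver using (solve-∀)
  open import Data.Bool using (Bool; true; false; if_then_else_)
  open import Data.List using (List; []; _∷_; _++_; map; length; [_]; head)
  open import Data.List.Relation.Unary.Linked as Linked using (Linked; []; [-]; _∷_; _∷′_)
  open import Data.Maybe.Base using (just)
  open import Data.Maybe.Relation.Binary.Connected using (Connected; just; just-nothing)
  open import Function.Bundles using (_↔_; mk↔ₛ′)
  open import Relation.Nullary using (Irrelevant)
  open Bijections using (Σ-≡-irrelevant)

  Strict : List ℕ → Set
  Strict = Linked _>_

  strict-irrelevant : ∀ xs → Irrelevant (Strict xs)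
  strict-irrelevant _ = Linked.irrelevant <-irrelevant

  StrictList : Set
  StrictList = Σ (List ℕ) Strict

  strict-zero-last : ∀ {xs} → Strict (zero ∷ xs) → xs ≡ []
  strict-zero-last [-]      = refl
  strict-zero-last (() ∷ _)

  bit : Bool → ℕ
  bit true  = 1
  bit false = 0

  lowerAll : List ℕ → List ℕ × Bool
  lowerAll []           = [] , false
  lowerAll (zero ∷ _)   = [] , true
  lowerAll (suc x ∷ xs) = x ∷ proj₁ (lowerAll xs) , proj₂ (lowerAll xs)

  raiseAll : List ℕ → Bool → List ℕ
  raiseAll xs z = map suc xs ++ (if z then [ 0 ] else [])

  lowerAll-strict : ∀ xs → Strict xs → Strict (proj₁ (lowerAll xs))
  lowerAll-strict []               _  = []
  lowerAll-strict (zero ∷ _)       _  = []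
  lowerAll-strict (suc x ∷ xs) sxs = headBound xs sxs ∷′ lowerAll-strict xs (Linked.tail sxs)
    where
    headBound : ∀ xs → Strict (suc x ∷ xs) → Connected _>_ (just x) (head (proj₁ (lowerAll xs)))
    headBound []           _              = just-nothing
    headBound (zero ∷ _)   _              = just-nothing
    headBound (suc y ∷ _)  (s≤s x>y ∷ _)  = just x>y

  raiseAll-strict : ∀ xs z → Strict xs → Strict (raiseAll xs z)
  raiseAll-strict []       false _   = []
  raiseAll-strict []       true  _   = [-]
  raiseAll-strict (x ∷ xs) z     sxs = headBound xs z sxs ∷′ raiseAll-strict xs z (Linked.tail sxs)
    where
    headBound : ∀ xs z → Strict (x ∷ xs) → Connected _>_ (just (suc x)) (head (raiseAll xs z))
    headBound []      false _          = just-nothing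
    headBound []      true  _          = just (s≤s z≤n)
    headBound (_ ∷ _) _     (x>y ∷ _)  = just (s≤s x>y)

  lowerAll-raiseAll : ∀ xs z → lowerAll (raiseAll xs z) ≡ (xs , z)
  lowerAll-raiseAll []       false = refl
  lowerAll-raiseAll []       true  = refl
  lowerAll-raiseAll (x ∷ xs) z rewrite lowerAll-raiseAll xs z = refl

  raiseAll-lowerAll : ∀ xs → Strict xs → raiseAll (proj₁ (lowerAll xs)) (proj₂ (lowerAll xs)) ≡ xs
  raiseAll-lowerAll []           _   = refl
  raiseAll-lowerAll (zero ∷ xs)  sxs rewrite strict-zero-last sxs = refl
  raiseAll-lowerAll (suc x ∷ xs) sxs = cong (suc x ∷_) (raiseAll-lowerAll xs (Linked.tail sxs))

  length-raiseAll : ∀ xs z → length (raiseAll xs z) ≡ length xs + bit z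
  length-raiseAll []       false = refl
  length-raiseAll []       true  = refl
  length-raiseAll (x ∷ xs) z     = cong suc (length-raiseAll xs z)

  sum-raiseAll : ∀ xs z → sum (raiseAll xs z) ≡ sum xs + length xs
  sum-raiseAll []       false = refl
  sum-raiseAll []       true  = refl
  sum-raiseAll (x ∷ xs) z     =
    trans (cong (suc x +_) (sum-raiseAll xs z)) (shuffle x (sum xs) (length xs))
    where
    shuffle : ∀ a b c → suc a + (b + c) ≡ a + b + suc c
    shuffle = solve-∀

  length-lowerAll : ∀ xs → Strict xs →
    length xs ≡ length (proj₁ (lowerAll xs)) + bit (proj₂ (lowerAll xs))
  length-lowerAll xs sxs = trans (cong length (sym (raiseAll-lowerAll xs sxs)))
                                 (length-raiseAll (proj₁ (lowerAll xs)) _)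

  sum-lowerAll : ∀ xs → Strict xs →
    sum xs ≡ sum (proj₁ (lowerAll xs)) + length (proj₁ (lowerAll xs))
  sum-lowerAll xs sxs = trans (cong sum (sym (raiseAll-lowerAll xs sxs)))
                              (sum-raiseAll (proj₁ (lowerAll xs)) _)

  lowering : StrictList ↔ (Bool × StrictList)
  lowering = mk↔ₛ′
    (λ { (X , sX) → proj₂ (lowerAll X) , proj₁ (lowerAll X) , lowerAll-strict X sX })
    (λ { (z , Y , sY) → raiseAll Y z , raiseAll-strict Y z sY })
    (λ { (z , Y , sY) → let e = lowerAll-raiseAll Y z in
                        cong₂ _,_ (cong proj₂ e) (Σ-≡-irrelevant strict-irrelevant (cong proj₁ e)) })
    (λ { (X , sX) → Σ-≡-irrelevant strict-irrelevant (raiseAll-lowerAll X sX) })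

-- Maya diagrams and the shift operators on them.
module MayaDiagrams where

  open import Data.Nat using (ℕ; zero; suc; _+_; _*_; _∸_)
  open import Data.Nat.Properties using (*-comm; *-distribʳ-+)
  open import Data.Nat.DivMod using (_/_; m*n/n≡m)
  import Data.Nat.Tactic.RingSolver as ℕ-Solver
  open import Data.Nat.ListAction using (sum)
  open import Data.Integer as ℤ using (ℤ; +_; -[1+_])
  import Data.Integer.Properties as ℤ
  open import Data.Integer.Tactic.RingSolver using (solve-∀)
  open import Data.Bool using (Bool; true; false; not)
  open import Data.Bool.Properties using (not-involutive)
  open import Data.List using (List; length)
  open import Relation.Nullary using (Irrelevant)
  open Bijections using (×-irrelevant)
  open StrictLists
  open ≡-Reasoning

  -- A configuration (P , Q) is a Maya diagram: the particles above the
  -- origin sit at the sites p + ½ (p ∈ P), the holes below it at -(q + ½)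
  -- (q ∈ Q); all other sites below the origin are occupied.
  Config : Set
  Config = List ℕ × List ℕ

  IsConfig : Config → Set
  IsConfig (P , Q) = Strict P × Strict Q

  -- The energy ΣP + ΣQ + |Q| sums the
  -- distances p + ½ and q + ½ of particles and holes from the origin, up to
  -- a correction (|P| - |Q|)/2 that vanishes at charge zero.
  particles holes : Config → ℕ
  particles (P , _) = length P
  holes     (_ , Q) = length Q

  charge : Config → ℤ
  charge c = + particles c ℤ.- + holes c

  energy : Config → ℕ
  energy (P , Q) = sum P + sum Q + length Q

  -- Moving every particle one site up: the site -½ is a hole exactly when
  -- 0 ∈ Q, and after the move the site +½ is occupied exactly when it was
  -- not a hole.  shiftDown is the reverse move.
  shiftUp : Config → Config
  shiftUp (P , Q) = raiseAll P (not (proj₂ (lowerAll Q))) , proj₁ (lowerAll Q)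

  shiftDown : Config → Config
  shiftDown (P , Q) = proj₁ (lowerAll P) , raiseAll Q (not (proj₂ (lowerAll P)))

  shiftUp-config : ∀ c → IsConfig c → IsConfig (shiftUp c)
  shiftUp-config (P , Q) (sP , sQ) = raiseAll-strict P _ sP , lowerAll-strict Q sQ

  shiftDown-config : ∀ c → IsConfig c → IsConfig (shiftDown c)
  shiftDown-config (P , Q) (sP , sQ) = lowerAll-strict P sP , raiseAll-strict Q _ sQ

  shiftDown-shiftUp : ∀ c → IsConfig c → shiftDown (shiftUp c) ≡ c
  shiftDown-shiftUp (P , Q) (_ , sQ)
    rewrite lowerAll-raiseAll P (not (proj₂ (lowerAll Q))) | not-involutive (proj₂ (lowerAll Q))
    = cong (P ,_) (raiseAll-lowerAll Q sQ)

  shiftUp-shiftDown : ∀ c → IsConfig c → shiftUp (shiftDown c) ≡ c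
  shiftUp-shiftDown (P , Q) (sP , _)
    rewrite lowerAll-raiseAll Q (not (proj₂ (lowerAll P))) | not-involutive (proj₂ (lowerAll P))
    = cong (_, Q) (raiseAll-lowerAll P sP)

  config-irrelevant : ∀ c → Irrelevant (IsConfig c)
  config-irrelevant (P , Q) = ×-irrelevant (strict-irrelevant P) (strict-irrelevant Q)

  -- Exactly one of the sites ±½ changes between particle and hole.
  bit-not : ∀ z → + bit (not z) ≡ + 1 ℤ.- + bit z
  bit-not true  = refl
  bit-not false = refl

  charge-shiftUp : ∀ c → IsConfig c → charge (shiftUp c) ≡ charge c ℤ.+ + 1
  charge-shiftUp (P , Q) (_ , sQ) = begin
    + length (raiseAll P (not z)) ℤ.- + length Q′
      ≡⟨ cong (λ n → + n ℤ.- + length Q′) (length-raiseAll P (not z)) ⟩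
    + length P ℤ.+ + bit (not z) ℤ.- + length Q′
      ≡⟨ cong (λ b → + length P ℤ.+ b ℤ.- + length Q′) (bit-not z) ⟩
    + length P ℤ.+ (+ 1 ℤ.- + bit z) ℤ.- + length Q′
      ≡⟨ rearrange (+ length P) (+ bit z) (+ length Q′) ⟩
    + length P ℤ.- (+ length Q′ ℤ.+ + bit z) ℤ.+ + 1
      ≡⟨ cong (λ n → + length P ℤ.- + n ℤ.+ + 1) (length-lowerAll Q sQ) ⟨
    + length P ℤ.- + length Q ℤ.+ + 1 ∎
    where
    Q′ : List ℕ
    Q′ = proj₁ (lowerAll Q)
    z : Bool
    z = proj₂ (lowerAll Q)
    rearrange : ∀ p b q → p ℤ.+ (+ 1 ℤ.- b) ℤ.- q ≡ p ℤ.- (q ℤ.+ b) ℤ.+ + 1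
    rearrange = solve-∀

  charge-shiftDown : ∀ c → IsConfig c → charge (shiftDown c) ≡ charge c ℤ.- + 1
  charge-shiftDown (P , Q) (sP , _) = begin
    + length P′ ℤ.- + length (raiseAll Q (not z))
      ≡⟨ cong (λ n → + length P′ ℤ.- + n) (length-raiseAll Q (not z)) ⟩
    + length P′ ℤ.- (+ length Q ℤ.+ + bit (not z))
      ≡⟨ cong (λ b → + length P′ ℤ.- (+ length Q ℤ.+ b)) (bit-not z) ⟩
    + length P′ ℤ.- (+ length Q ℤ.+ (+ 1 ℤ.- + bit z))
      ≡⟨ rearrange (+ length P′) (+ bit z) (+ length Q) ⟩
    + length P′ ℤ.+ + bit z ℤ.- + length Q ℤ.- + 1
      ≡⟨ cong (λ n → + n ℤ.- + length Q ℤ.- + 1) (length-lowerAll P sP) ⟨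
    + length P ℤ.- + length Q ℤ.- + 1 ∎
    where
    P′ : List ℕ
    P′ = proj₁ (lowerAll P)
    z : Bool
    z = proj₂ (lowerAll P)
    rearrange : ∀ p b q → p ℤ.- (q ℤ.+ (+ 1 ℤ.- b)) ≡ p ℤ.+ b ℤ.- q ℤ.- + 1
    rearrange = solve-∀

  energy-shiftUp : ∀ c → IsConfig c → + energy (shiftUp c) ≡ + energy c ℤ.+ charge c
  energy-shiftUp (P , Q) (_ , sQ) = begin
    + (sum (raiseAll P (not z)) + sum Q′ + length Q′)
      ≡⟨ cong (λ s → + (s + sum Q′ + length Q′)) (sum-raiseAll P (not z)) ⟩
    + (sum P + length P + sum Q′ + length Q′)
      ≡⟨ rearrange (+ sum P) (+ length P) (+ sum Q′) (+ length Q′) (+ length Q) ⟩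
    + (sum P + (sum Q′ + length Q′) + length Q) ℤ.+ charge (P , Q)
      ≡⟨ cong (λ s → + (sum P + s + length Q) ℤ.+ charge (P , Q)) (sum-lowerAll Q sQ) ⟨
    + energy (P , Q) ℤ.+ charge (P , Q) ∎
    where
    Q′ : List ℕ
    Q′ = proj₁ (lowerAll Q)
    z : Bool
    z = proj₂ (lowerAll Q)
    rearrange : ∀ s p s′ l q → s ℤ.+ p ℤ.+ s′ ℤ.+ l ≡ s ℤ.+ (s′ ℤ.+ l) ℤ.+ q ℤ.+ (p ℤ.- q)
    rearrange = solve-∀

  energy-shiftDown : ∀ c → IsConfig c → + energy (shiftDown c) ≡ + energy c ℤ.- charge c ℤ.+ + 1
  energy-shiftDown (P , Q) (sP , _) = begin
    + (sum P′ + sum (raiseAll Q (not z)) + length (raiseAll Q (not z)))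
      ≡⟨ cong₂ (λ s l → + (sum P′ + s + l)) (sum-raiseAll Q (not z)) (length-raiseAll Q (not z)) ⟩
    + sum P′ ℤ.+ (+ sum Q ℤ.+ + length Q) ℤ.+ (+ length Q ℤ.+ + bit (not z))
      ≡⟨ cong (λ b → + sum P′ ℤ.+ (+ sum Q ℤ.+ + length Q) ℤ.+ (+ length Q ℤ.+ b)) (bit-not z) ⟩
    + sum P′ ℤ.+ (+ sum Q ℤ.+ + length Q) ℤ.+ (+ length Q ℤ.+ (+ 1 ℤ.- + bit z))
      ≡⟨ rearrange (+ sum P′) (+ length P′) (+ sum Q) (+ length Q) (+ bit z) ⟩
    + (sum P′ + length P′) ℤ.+ + sum Q ℤ.+ + length Q ℤ.- (+ (length P′ + bit z) ℤ.- + length Q) ℤ.+ + 1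
      ≡⟨ cong₂ (λ s l → + s ℤ.+ + sum Q ℤ.+ + length Q ℤ.- (+ l ℤ.- + length Q) ℤ.+ + 1)
               (sum-lowerAll P sP) (length-lowerAll P sP) ⟨
    + energy (P , Q) ℤ.- charge (P , Q) ℤ.+ + 1 ∎
    where
    P′ : List ℕ
    P′ = proj₁ (lowerAll P)
    z : Bool
    z = proj₂ (lowerAll P)
    rearrange : ∀ s l t q b → s ℤ.+ (t ℤ.+ q) ℤ.+ (q ℤ.+ (+ 1 ℤ.- b)) ≡
                              s ℤ.+ l ℤ.+ t ℤ.+ q ℤ.- (l ℤ.+ b ℤ.- q) ℤ.+ + 1
    rearrange = solve-∀

  triangle : ℕ → ℕ
  triangle zero    = 0
  triangle (suc n) = triangle n + n

  -- Iterated shifts.  The new shift is applied outermost in shiftUpBy and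
  -- innermost in shiftDownBy, so that both inverse laws are plain inductions.
  shiftUpBy : ℕ → Config → Config
  shiftUpBy zero    c = c
  shiftUpBy (suc n) c = shiftUp (shiftUpBy n c)

  shiftDownBy : ℕ → Config → Config
  shiftDownBy zero    c = c
  shiftDownBy (suc n) c = shiftDownBy n (shiftDown c)

  shiftUpBy-config : ∀ n c → IsConfig c → IsConfig (shiftUpBy n c)
  shiftUpBy-config zero    c v = v
  shiftUpBy-config (suc n) c v = shiftUp-config _ (shiftUpBy-config n c v)

  shiftDownBy-config : ∀ n c → IsConfig c → IsConfig (shiftDownBy n c)
  shiftDownBy-config zero    c v = v
  shiftDownBy-config (suc n) c v = shiftDownBy-config n _ (shiftDown-config c v)

  shiftDownBy-shiftUpBy : ∀ n c → IsConfig c → shiftDownBy n (shiftUpBy n c) ≡ c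
  shiftDownBy-shiftUpBy zero    c v = refl
  shiftDownBy-shiftUpBy (suc n) c v =
    trans (cong (shiftDownBy n) (shiftDown-shiftUp _ (shiftUpBy-config n c v)))
          (shiftDownBy-shiftUpBy n c v)

  shiftUpBy-shiftDownBy : ∀ n c → IsConfig c → shiftUpBy n (shiftDownBy n c) ≡ c
  shiftUpBy-shiftDownBy zero    c v = refl
  shiftUpBy-shiftDownBy (suc n) c v =
    trans (cong shiftUp (shiftUpBy-shiftDownBy n _ (shiftDown-config c v)))
          (shiftUp-shiftDown c v)

  charge-shiftUpBy : ∀ n c → IsConfig c → charge (shiftUpBy n c) ≡ charge c ℤ.+ + n
  charge-shiftUpBy zero    c v = sym (ℤ.+-identityʳ (charge c))
  charge-shiftUpBy (suc n) c v = begin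
    charge (shiftUp (shiftUpBy n c)) ≡⟨ charge-shiftUp _ (shiftUpBy-config n c v) ⟩
    charge (shiftUpBy n c) ℤ.+ + 1   ≡⟨ cong (ℤ._+ + 1) (charge-shiftUpBy n c v) ⟩
    charge c ℤ.+ + n ℤ.+ + 1         ≡⟨ rearrange (charge c) (+ n) ⟩
    charge c ℤ.+ + suc n             ∎
    where
    rearrange : ∀ q n → q ℤ.+ n ℤ.+ + 1 ≡ q ℤ.+ (+ 1 ℤ.+ n)
    rearrange = solve-∀

  charge-shiftDownBy : ∀ n c → IsConfig c → charge (shiftDownBy n c) ≡ charge c ℤ.- + n
  charge-shiftDownBy zero    c v = sym (ℤ.+-identityʳ (charge c))
  charge-shiftDownBy (suc n) c v = begin
    charge (shiftDownBy n (shiftDown c)) ≡⟨ charge-shiftDownBy n _ (shiftDown-config c v) ⟩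
    charge (shiftDown c) ℤ.- + n         ≡⟨ cong (ℤ._- + n) (charge-shiftDown c v) ⟩
    charge c ℤ.- + 1 ℤ.- + n             ≡⟨ rearrange (charge c) (+ n) ⟩
    charge c ℤ.- + suc n                 ∎
    where
    rearrange : ∀ q n → q ℤ.- + 1 ℤ.- n ≡ q ℤ.- (+ 1 ℤ.+ n)
    rearrange = solve-∀

  energy-shiftUpBy : ∀ n c → IsConfig c →
    + energy (shiftUpBy n c) ≡ + energy c ℤ.+ + n ℤ.* charge c ℤ.+ + triangle n
  energy-shiftUpBy zero    c v = rearrange (+ energy c) (charge c)
    where
    rearrange : ∀ e q → e ≡ e ℤ.+ + 0 ℤ.* q ℤ.+ + 0
    rearrange = solve-∀
  energy-shiftUpBy (suc n) c v = begin
    + energy (shiftUp (shiftUpBy n c))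
      ≡⟨ energy-shiftUp _ (shiftUpBy-config n c v) ⟩
    + energy (shiftUpBy n c) ℤ.+ charge (shiftUpBy n c)
      ≡⟨ cong₂ ℤ._+_ (energy-shiftUpBy n c v) (charge-shiftUpBy n c v) ⟩
    + energy c ℤ.+ + n ℤ.* charge c ℤ.+ + triangle n ℤ.+ (charge c ℤ.+ + n)
      ≡⟨ rearrange (+ energy c) (charge c) (+ n) (+ triangle n) ⟩
    + energy c ℤ.+ + suc n ℤ.* charge c ℤ.+ + triangle (suc n) ∎
    where
    rearrange : ∀ e q n t → e ℤ.+ n ℤ.* q ℤ.+ t ℤ.+ (q ℤ.+ n) ≡ e ℤ.+ (+ 1 ℤ.+ n) ℤ.* q ℤ.+ (t ℤ.+ n)
    rearrange = solve-∀

  energy-shiftDownBy : ∀ n c → IsConfig c →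
    + energy (shiftDownBy n c) ≡ + energy c ℤ.- + n ℤ.* charge c ℤ.+ + triangle (suc n)
  energy-shiftDownBy zero    c v = rearrange (+ energy c) (charge c)
    where
    rearrange : ∀ e q → e ≡ e ℤ.- + 0 ℤ.* q ℤ.+ + 0
    rearrange = solve-∀
  energy-shiftDownBy (suc n) c v = begin
    + energy (shiftDownBy n (shiftDown c))
      ≡⟨ energy-shiftDownBy n _ (shiftDown-config c v) ⟩
    + energy (shiftDown c) ℤ.- + n ℤ.* charge (shiftDown c) ℤ.+ + triangle (suc n)
      ≡⟨ cong₂ (λ e q → e ℤ.- + n ℤ.* q ℤ.+ + triangle (suc n)) (energy-shiftDown c v) (charge-shiftDown c v) ⟩
    + energy c ℤ.- charge c ℤ.+ + 1 ℤ.- + n ℤ.* (charge c ℤ.- + 1) ℤ.+ + triangle (suc n)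
      ≡⟨ rearrange (+ energy c) (charge c) (+ n) (+ triangle (suc n)) ⟩
    + energy c ℤ.- + suc n ℤ.* charge c ℤ.+ + triangle (suc (suc n)) ∎
    where
    rearrange : ∀ e q n t → e ℤ.- q ℤ.+ + 1 ℤ.- n ℤ.* (q ℤ.- + 1) ℤ.+ t ≡
                            e ℤ.- (+ 1 ℤ.+ n) ℤ.* q ℤ.+ (t ℤ.+ (+ 1 ℤ.+ n))
    rearrange = solve-∀

  triangle-double : ∀ n → triangle n * 2 ≡ n * (n ∸ 1)
  triangle-double zero          = refl
  triangle-double (suc zero)    = refl
  triangle-double (suc (suc n)) = begin
    (triangle (suc n) + suc n) * 2     ≡⟨ *-distribʳ-+ 2 (triangle (suc n)) (suc n) ⟩
    triangle (suc n) * 2 + suc n * 2   ≡⟨ cong (_+ suc n * 2) (triangle-double (suc n)) ⟩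
    suc n * n + suc n * 2              ≡⟨ rearrange n ⟩
    suc (suc n) * suc n                ∎
    where
    rearrange : ∀ n → suc n * n + suc n * 2 ≡ suc (suc n) * suc n
    rearrange = ℕ-Solver.solve-∀

  binom2-triangle : ∀ n → binom2 (+ n) ≡ + triangle n
  binom2-triangle n =
    cong +_ (trans (cong (_/ 2) (sym (triangle-double n))) (m*n/n≡m (triangle n) 2))

  binom2-negative : ∀ n → binom2 -[1+ n ] ≡ + triangle (suc (suc n))
  binom2-negative n = cong +_ (begin
    (suc n * suc (suc n)) / 2           ≡⟨ cong (_/ 2) (*-comm (suc n) (suc (suc n))) ⟩
    (suc (suc n) * suc n) / 2           ≡⟨ ℤ.+-injective (binom2-triangle (suc (suc n))) ⟩
    triangle (suc (suc n))              ∎)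

  shift : ℤ → Config → Config
  shift (+ n)    = shiftUpBy n
  shift -[1+ n ] = shiftDownBy (suc n)

  shift-config : ∀ d c → IsConfig c → IsConfig (shift d c)
  shift-config (+ n)    = shiftUpBy-config n
  shift-config -[1+ n ] = shiftDownBy-config (suc n)

  shift-inverse : ∀ d c → IsConfig c → shift (ℤ.- d) (shift d c) ≡ c
  shift-inverse (+ zero)  c v = refl
  shift-inverse (+ suc n) c v = shiftDownBy-shiftUpBy (suc n) c v
  shift-inverse -[1+ n ]  c v = shiftUpBy-shiftDownBy (suc n) c v

  shift-inverse′ : ∀ d c → IsConfig c → shift d (shift (ℤ.- d) c) ≡ c
  shift-inverse′ d c v =
    subst (λ e → shift e (shift (ℤ.- d) c) ≡ c) (ℤ.neg-involutive d) (shift-inverse (ℤ.- d) c v)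

  charge-shift : ∀ d c → IsConfig c → charge (shift d c) ≡ charge c ℤ.+ d
  charge-shift (+ n)    = charge-shiftUpBy n
  charge-shift -[1+ n ] = charge-shiftDownBy (suc n)

  energy-shift : ∀ d c → IsConfig c →
    + energy (shift d c) ≡ + energy c ℤ.+ d ℤ.* charge c ℤ.+ binom2 d
  energy-shift (+ n) c v =
    trans (energy-shiftUpBy n c v) (cong (λ b → + energy c ℤ.+ + n ℤ.* charge c ℤ.+ b) (sym (binom2-triangle n)))
  energy-shift -[1+ n ] c v = begin
    + energy (shiftDownBy (suc n) c)
      ≡⟨ energy-shiftDownBy (suc n) c v ⟩
    + energy c ℤ.- + suc n ℤ.* charge c ℤ.+ + triangle (suc (suc n))
      ≡⟨ rearrange (+ energy c) (+ suc n) (charge c) (+ triangle (suc (suc n))) ⟩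
    + energy c ℤ.+ -[1+ n ] ℤ.* charge c ℤ.+ + triangle (suc (suc n))
      ≡⟨ cong (λ b → + energy c ℤ.+ -[1+ n ] ℤ.* charge c ℤ.+ b) (sym (binom2-negative n)) ⟩
    + energy c ℤ.+ -[1+ n ] ℤ.* charge c ℤ.+ binom2 -[1+ n ] ∎
    where
    rearrange : ∀ e a q t → e ℤ.- a ℤ.* q ℤ.+ t ≡ e ℤ.+ ℤ.- a ℤ.* q ℤ.+ t
    rearrange = solve-∀

-- Charge-zero configurations are the same as finite sets of positive
-- integers: fill all holes by shifting up.
module BalancedConfigs where

  open import Data.Nat using (ℕ; zero; suc; _+_; _∸_; _≤_; z≤n; s≤s; pred)
  open import Data.Nat.Properties using (+-identityʳ; +-suc; m+n∸n≡m; n∸n≡0; pred[m∸n]≡m∸[1+n]; ≤-irrelevant)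
  open import Data.Nat.ListAction using (sum)
  open import Data.Integer as ℤ using (ℤ; +_)
  import Data.Integer.Properties as ℤ
  open import Data.Integer.Tactic.RingSolver using (solve-∀)
  open import Data.Bool using (false)
  open import Data.List using (List; []; _∷_; length)
  open import Data.List.Relation.Unary.All as All using (All; []; _∷_)
  open import Data.List.Relation.Unary.Linked using ([])
  open import Function.Bundles using (_↔_; mk↔ₛ′)
  open import Relation.Nullary using (Irrelevant)
  open import Axiom.UniquenessOfIdentityProofs using (module Decidable⇒UIP)
  open Bijections using (Σ-≡-irrelevant; ×-irrelevant)
  open StrictLists
  open MayaDiagrams
  open ≡-Reasoning

  Positive : List ℕ → Set
  Positive = All (λ x → 1 ≤ x)

  StrictPositive : Set
  StrictPositive = Σ (List ℕ) (λ X → Strict X × Positive X)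

  IsBalanced : Config → Set
  IsBalanced c = IsConfig c × charge c ≡ + 0

  Balanced : Set
  Balanced = Σ Config IsBalanced

  balanced-irrelevant : ∀ c → Irrelevant (IsBalanced c)
  balanced-irrelevant c = ×-irrelevant (config-irrelevant c) (Decidable⇒UIP.≡-irrelevant ℤ._≟_)

  -- reach Q: the number of up-shifts needed to fill all the holes.
  reach : List ℕ → ℕ
  reach []      = 0
  reach (q ∷ _) = suc q

  reach-lowerAll : ∀ Q → reach (proj₁ (lowerAll Q)) ≡ pred (reach Q)
  reach-lowerAll []          = refl
  reach-lowerAll (zero ∷ _)  = refl
  reach-lowerAll (suc _ ∷ _) = refl

  reach-shiftUpBy : ∀ n c → reach (proj₂ (shiftUpBy n c)) ≡ reach (proj₂ c) ∸ n
  reach-shiftUpBy zero    c = refl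
  reach-shiftUpBy (suc n) c = begin
    reach (proj₁ (lowerAll (proj₂ (shiftUpBy n c)))) ≡⟨ reach-lowerAll (proj₂ (shiftUpBy n c)) ⟩
    pred (reach (proj₂ (shiftUpBy n c)))            ≡⟨ cong pred (reach-shiftUpBy n c) ⟩
    pred (reach (proj₂ c) ∸ n)                      ≡⟨ pred[m∸n]≡m∸[1+n] (reach (proj₂ c)) n ⟩
    reach (proj₂ c) ∸ suc n                         ∎

  -- After reach Q up-shifts no hole is left ...
  shiftUpBy-reach-holes : ∀ c → proj₂ (shiftUpBy (reach (proj₂ c)) c) ≡ []
  shiftUpBy-reach-holes c = reach≡0 (trans (reach-shiftUpBy (reach (proj₂ c)) c) (n∸n≡0 (reach (proj₂ c))))
    where
    reach≡0 : ∀ {Q} → reach Q ≡ 0 → Q ≡ []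
    reach≡0 {[]} _ = refl

  -- ... and for a balanced configuration the particles then all sit at
  -- positive sites, since the last up-shift filled the hole at -½.
  shiftUpBy-reach-positive : ∀ c → IsBalanced c → Positive (proj₁ (shiftUpBy (reach (proj₂ c)) c))
  shiftUpBy-reach-positive ([]    , [])    _        = []
  shiftUpBy-reach-positive (_ ∷ _ , [])    (_ , ())
  shiftUpBy-reach-positive (P , q ∷ Q)     _        =
    shiftUp-positive (shiftUpBy q (P , q ∷ Q)) (trans (reach-shiftUpBy q (P , q ∷ Q)) (m+n∸n≡m 1 q))
    where
    raised-positive : ∀ xs → Positive (raiseAll xs false)
    raised-positive []       = []
    raised-positive (x ∷ xs) = s≤s z≤n ∷ raised-positive xs
    shiftUp-positive : ∀ c → reach (proj₂ c) ≡ 1 → Positive (proj₁ (shiftUp c))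
    shiftUp-positive (_ , [])           ()
    shiftUp-positive (P , zero ∷ _)     refl = raised-positive P
    shiftUp-positive (_ , suc _ ∷ _)    ()

  strictPositive-irrelevant : ∀ X → Irrelevant (Strict X × Positive X)
  strictPositive-irrelevant X = ×-irrelevant (strict-irrelevant X) (All.irrelevant ≤-irrelevant)

  fill : Balanced → StrictPositive
  fill (c , b@(v , _)) =
    proj₁ (shiftUpBy (reach (proj₂ c)) c) ,
    proj₁ (shiftUpBy-config (reach (proj₂ c)) c v) ,
    shiftUpBy-reach-positive c b

  fill-length : ∀ c → IsBalanced c → length (proj₁ (shiftUpBy (reach (proj₂ c)) c)) ≡ reach (proj₂ c)
  fill-length c (v , e) = ℤ.+-injective (begin
    + length P′
      ≡⟨ ℤ.+-identityʳ (+ length P′) ⟨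
    + length P′ ℤ.- + length {A = ℕ} []
      ≡⟨ cong (λ Q → + length P′ ℤ.- + length Q) (shiftUpBy-reach-holes c) ⟨
    charge (shiftUpBy r c)
      ≡⟨ charge-shiftUpBy r c v ⟩
    charge c ℤ.+ + r
      ≡⟨ cong (ℤ._+ + r) e ⟩
    + r ∎)
    where
    r : ℕ
    r = reach (proj₂ c)
    P′ : List ℕ
    P′ = proj₁ (shiftUpBy r c)

  charge-unfill : ∀ X → Strict X → charge (shiftDownBy (length X) (X , [])) ≡ + 0
  charge-unfill X sX = trans (charge-shiftDownBy (length X) (X , []) (sX , [])) (cancel (+ length X))
    where
    cancel : ∀ x → x ℤ.- + 0 ℤ.- x ≡ + 0
    cancel = solve-∀

  unfill : StrictPositive → Balanced
  unfill (X , sX , _) =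
    shiftDownBy (length X) (X , []) , shiftDownBy-config (length X) (X , []) (sX , []) , charge-unfill X sX

  -- Conversely, unfilling a set X of positive integers creates holes
  -- reaching exactly |X|: the first down-shift opens the hole at -½, and
  -- every further one moves the holes one site down.
  reach-shiftDownBy : ∀ n P q Q → reach (proj₂ (shiftDownBy n (P , q ∷ Q))) ≡ suc q + n
  reach-shiftDownBy zero    P q Q = sym (+-identityʳ (suc q))
  reach-shiftDownBy (suc n) P q Q = trans (reach-shiftDownBy n _ (suc q) _) (sym (+-suc (suc q) n))

  lowerAll-positive : ∀ xs → Positive xs → proj₂ (lowerAll xs) ≡ false
  lowerAll-positive []           _         = refl
  lowerAll-positive (suc x ∷ xs) (_ ∷ pos) = lowerAll-positive xs pos

  reach-unfill : ∀ X → Positive X → reach (proj₂ (shiftDownBy (length X) (X , []))) ≡ length X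
  reach-unfill []       _   = refl
  reach-unfill (x ∷ xs) pos rewrite lowerAll-positive (x ∷ xs) pos = reach-shiftDownBy (length xs) _ 0 []

  fill-unfill : ∀ X → fill (unfill X) ≡ X
  fill-unfill (X , sX , pX) = Σ-≡-irrelevant strictPositive-irrelevant (begin
    proj₁ (shiftUpBy (reach (proj₂ D)) D)   ≡⟨ cong (λ n → proj₁ (shiftUpBy n D)) (reach-unfill X pX) ⟩
    proj₁ (shiftUpBy (length X) D)          ≡⟨ cong proj₁ (shiftUpBy-shiftDownBy (length X) (X , []) (sX , [])) ⟩
    X                                       ∎)
    where
    D : Config
    D = shiftDownBy (length X) (X , [])

  unfill-fill : ∀ c → unfill (fill c) ≡ c
  unfill-fill (c , b@(v , _)) = Σ-≡-irrelevant balanced-irrelevant (begin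
    shiftDownBy (length P′) (P′ , [])
      ≡⟨ cong₂ shiftDownBy (fill-length c b) (cong (P′ ,_) (sym (shiftUpBy-reach-holes c))) ⟩
    shiftDownBy r (shiftUpBy r c)
      ≡⟨ shiftDownBy-shiftUpBy r c v ⟩
    c ∎)
    where
    r : ℕ
    r = reach (proj₂ c)
    P′ : List ℕ
    P′ = proj₁ (shiftUpBy r c)

  balanced↔strictPositive : Balanced ↔ StrictPositive
  balanced↔strictPositive = mk↔ₛ′ fill unfill fill-unfill unfill-fill

  energy-unfill : ∀ X → Strict X → energy (shiftDownBy (length X) (X , [])) + triangle (length X) ≡ sum X
  energy-unfill X sX = ℤ.+-injective (begin
    + energy D ℤ.+ + triangle n
      ≡⟨ zeroTerm (+ energy D) (+ n) (+ triangle n) ⟩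
    + energy D ℤ.+ + n ℤ.* + 0 ℤ.+ + triangle n
      ≡⟨ cong (λ q → + energy D ℤ.+ + n ℤ.* q ℤ.+ + triangle n) (charge-unfill X sX) ⟨
    + energy D ℤ.+ + n ℤ.* charge D ℤ.+ + triangle n
      ≡⟨ energy-shiftUpBy n D (shiftDownBy-config n (X , []) (sX , [])) ⟨
    + energy (shiftUpBy n D)
      ≡⟨ cong (λ c → + energy c) (shiftUpBy-shiftDownBy n (X , []) (sX , [])) ⟩
    + (sum X + 0 + 0)
      ≡⟨ cong +_ (trans (+-identityʳ _) (+-identityʳ _)) ⟩
    + sum X ∎)
    where
    n : ℕ
    n = length X
    D : Config
    D = shiftDownBy n (X , [])
    zeroTerm : ∀ e n t → e ℤ.+ t ≡ e ℤ.+ n ℤ.* + 0 ℤ.+ t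
    zeroTerm = solve-∀

module JacobiTripleProduct where

  open import Data.Nat using (ℕ; zero; suc; _+_; _∸_; _≤_; _<_; _≥_; z≤n; s≤s)
  open import Data.Nat.Properties
    using (+-cancelʳ-≡; +-mono-≤-<; <⇒≤; m+n∸n≡m; m<n⇒0<n∸m; m∸n+n≡m; m≤m+n; n<1+n;
           ≤-<-trans; ≤-irrelevant; ≤-trans)
  open import Data.Nat.ListAction using (sum)
  import Data.Nat.Tactic.RingSolver as ℕ-Solver
  open import Data.Integer as ℤ using (ℤ; +_)
  import Data.Integer.Properties as ℤ
  open import Data.List using (List; []; _∷_; length)
  open import Data.List.Relation.Unary.All as All using (All; []; _∷_)
  open import Data.List.Relation.Unary.Linked as Linked using (Linked; []; [-]; _∷_)
  open import Function.Bundles using (_↔_; mk↔ₛ′)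
  open import Function.Properties.Inverse using (↔-trans; ↔-sym)
  open import Relation.Nullary using (Irrelevant)
  open Bijections using (to; from; to-from; from-to; Σ-≡-irrelevant; ×-irrelevant)
  open StrictLists
  open MayaDiagrams
  open BalancedConfigs
  open ≡-Reasoning

  -- Adding the staircase (n-1, …, 1, 0) to a partition with n parts makes
  -- its parts distinct; this identifies partitions with finite sets of
  -- positive integers, at the cost of the triangular number n(n-1)/2.
  addStaircase : List ℕ → List ℕ
  addStaircase []       = []
  addStaircase (x ∷ xs) = x + length xs ∷ addStaircase xs

  removeStaircase : List ℕ → List ℕ
  removeStaircase []       = []
  removeStaircase (x ∷ xs) = x ∸ length xs ∷ removeStaircase xs

  length-addStaircase : ∀ l → length (addStaircase l) ≡ length l
  length-addStaircase []       = refl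
  length-addStaircase (x ∷ xs) = cong suc (length-addStaircase xs)

  length-removeStaircase : ∀ l → length (removeStaircase l) ≡ length l
  length-removeStaircase []       = refl
  length-removeStaircase (x ∷ xs) = cong suc (length-removeStaircase xs)

  sum-addStaircase : ∀ l → sum (addStaircase l) ≡ sum l + triangle (length l)
  sum-addStaircase []       = refl
  sum-addStaircase (x ∷ xs) = begin
    x + length xs + sum (addStaircase xs)            ≡⟨ cong (λ s → x + length xs + s) (sum-addStaircase xs) ⟩
    x + length xs + (sum xs + triangle (length xs))  ≡⟨ rearrange x (length xs) (sum xs) (triangle (length xs)) ⟩
    x + sum xs + (triangle (length xs) + length xs)  ∎
    where
    rearrange : ∀ a b c d → a + b + (c + d) ≡ a + c + (d + b)
    rearrange = ℕ-Solver.solve-∀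

  removeStaircase-addStaircase : ∀ l → removeStaircase (addStaircase l) ≡ l
  removeStaircase-addStaircase []       = refl
  removeStaircase-addStaircase (x ∷ xs) = cong₂ _∷_
    (trans (cong (λ n → x + length xs ∸ n) (length-addStaircase xs)) (m+n∸n≡m x (length xs)))
    (removeStaircase-addStaircase xs)

  length-tail<head : ∀ x xs → Strict (x ∷ xs) → Positive (x ∷ xs) → length xs < x
  length-tail<head x []       _           (1≤x ∷ _) = 1≤x
  length-tail<head x (y ∷ ys) (x>y ∷ sys) (_ ∷ pos) = ≤-<-trans (length-tail<head y ys sys pos) x>y

  addStaircase-removeStaircase : ∀ l → Strict l → Positive l → addStaircase (removeStaircase l) ≡ l
  addStaircase-removeStaircase []       _   _   = refl
  addStaircase-removeStaircase (x ∷ xs) sxs pos = cong₂ _∷_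
    (trans (cong (λ n → x ∸ length xs + n) (length-removeStaircase xs))
           (m∸n+n≡m (<⇒≤ (length-tail<head x xs sxs pos))))
    (addStaircase-removeStaircase xs (Linked.tail sxs) (All.tail pos))

  addStaircase-strict : ∀ l → Linked _≥_ l → Strict (addStaircase l)
  addStaircase-strict []           _          = []
  addStaircase-strict (x ∷ [])     _          = [-]
  addStaircase-strict (x ∷ y ∷ ys) (x≥y ∷ lk) =
    +-mono-≤-< x≥y (n<1+n (length ys)) ∷ addStaircase-strict (y ∷ ys) lk

  addStaircase-positive : ∀ l → Positive l → Positive (addStaircase l)
  addStaircase-positive []       _          = []
  addStaircase-positive (x ∷ xs) (1≤x ∷ ps) = ≤-trans 1≤x (m≤m+n x _) ∷ addStaircase-positive xs ps

  removeStaircase-weak : ∀ l → Strict l → Linked _≥_ (removeStaircase l)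
  removeStaircase-weak []           _           = []
  removeStaircase-weak (x ∷ [])     _           = [-]
  removeStaircase-weak (x ∷ y ∷ ys) (x>y ∷ sys) = step x y (length ys) x>y ∷ removeStaircase-weak (y ∷ ys) sys
    where
    step : ∀ x y k → y < x → y ∸ k ≤ x ∸ suc k
    step x       y       zero    (s≤s y≤x) = y≤x
    step (suc x) zero    (suc k) _         = z≤n
    step (suc x) (suc y) (suc k) (s≤s y<x) = step x y k y<x

  removeStaircase-positive : ∀ l → Strict l → Positive l → Positive (removeStaircase l)
  removeStaircase-positive []       _   _   = []
  removeStaircase-positive (x ∷ xs) sxs pos =
    m<n⇒0<n∸m (length-tail<head x xs sxs pos) ∷ removeStaircase-positive xs (Linked.tail sxs) (All.tail pos)

  isPartition-irrelevant : ∀ l → Irrelevant (IsPartition l)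
  isPartition-irrelevant l = ×-irrelevant (All.irrelevant ≤-irrelevant) (Linked.irrelevant ≤-irrelevant)

  partition↔strictPositive : Partition ↔ StrictPositive
  partition↔strictPositive = mk↔ₛ′
    (λ { (l , pos , lk) → addStaircase l , addStaircase-strict l lk , addStaircase-positive l pos })
    (λ { (X , sX , pX) → removeStaircase X , removeStaircase-positive X sX pX , removeStaircase-weak X sX })
    (λ { (X , sX , pX) → Σ-≡-irrelevant strictPositive-irrelevant (addStaircase-removeStaircase X sX pX) })
    (λ { (l , _ , _)   → Σ-≡-irrelevant isPartition-irrelevant (removeStaircase-addStaircase l) })

  partition↔balanced : Partition ↔ Balanced
  partition↔balanced = ↔-trans partition↔strictPositive (↔-sym balanced↔strictPositive)

  config₀ : Partition → Config
  config₀ ν = proj₁ (to partition↔balanced ν)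

  config₀-valid : ∀ ν → IsConfig (config₀ ν)
  config₀-valid ν = proj₁ (proj₂ (to partition↔balanced ν))

  charge-config₀ : ∀ ν → charge (config₀ ν) ≡ + 0
  charge-config₀ ν = proj₂ (proj₂ (to partition↔balanced ν))

  energy-config₀ : ∀ ν → energy (config₀ ν) ≡ size ν
  energy-config₀ ν@(l , pos , lk) = +-cancelʳ-≡ (triangle (length l)) _ _ (begin
    energy (config₀ ν) + triangle (length l)
      ≡⟨ cong (λ n → energy (config₀ ν) + triangle n) (length-addStaircase l) ⟨
    energy (config₀ ν) + triangle (length X)
      ≡⟨ energy-unfill X (addStaircase-strict l lk) ⟩
    sum X
      ≡⟨ sum-addStaircase l ⟩
    sum l + triangle (length l) ∎)
    where
    X : List ℕ
    X = addStaircase l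

  ValidConfig : Set
  ValidConfig = Σ Config IsConfig

  toConfig : Partition × ℤ → ValidConfig
  toConfig (ν , d) = shift d (config₀ ν) , shift-config d (config₀ ν) (config₀-valid ν)

  rebalance : ValidConfig → Balanced
  rebalance (c , v) = shift (ℤ.- charge c) c , shift-config (ℤ.- charge c) c v ,
                      trans (charge-shift (ℤ.- charge c) c v) (ℤ.+-inverseʳ (charge c))

  fromConfig : ValidConfig → Partition × ℤ
  fromConfig (c , v) = from partition↔balanced (rebalance (c , v)) , charge c

  charge-toConfig : ∀ ν d → charge (proj₁ (toConfig (ν , d))) ≡ d
  charge-toConfig ν d = begin
    charge (shift d (config₀ ν))  ≡⟨ charge-shift d (config₀ ν) (config₀-valid ν) ⟩
    charge (config₀ ν) ℤ.+ d      ≡⟨ cong (ℤ._+ d) (charge-config₀ ν) ⟩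
    + 0 ℤ.+ d                     ≡⟨ ℤ.+-identityˡ d ⟩
    d                             ∎

  energy-toConfig : ∀ ν d → + energy (proj₁ (toConfig (ν , d))) ≡ + size ν ℤ.+ binom2 d
  energy-toConfig ν d = begin
    + energy (shift d (config₀ ν))
      ≡⟨ energy-shift d (config₀ ν) (config₀-valid ν) ⟩
    + energy (config₀ ν) ℤ.+ d ℤ.* charge (config₀ ν) ℤ.+ binom2 d
      ≡⟨ cong₂ (λ e q → + e ℤ.+ d ℤ.* q ℤ.+ binom2 d) (energy-config₀ ν) (charge-config₀ ν) ⟩
    + size ν ℤ.+ d ℤ.* + 0 ℤ.+ binom2 d
      ≡⟨ cong (λ x → + size ν ℤ.+ x ℤ.+ binom2 d) (ℤ.*-zeroʳ d) ⟩
    + size ν ℤ.+ + 0 ℤ.+ binom2 d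
      ≡⟨ cong (ℤ._+ binom2 d) (ℤ.+-identityʳ (+ size ν)) ⟩
    + size ν ℤ.+ binom2 d ∎

  jacobi : (Partition × ℤ) ↔ ValidConfig
  jacobi = mk↔ₛ′ toConfig fromConfig toConfig-fromConfig fromConfig-toConfig
    where
    toConfig-fromConfig : ∀ x → toConfig (fromConfig x) ≡ x
    toConfig-fromConfig (c , v) = Σ-≡-irrelevant config-irrelevant (begin
      shift q (proj₁ (to partition↔balanced (from partition↔balanced (rebalance (c , v)))))
        ≡⟨ cong (λ b → shift q (proj₁ b)) (to-from partition↔balanced (rebalance (c , v))) ⟩
      shift q (shift (ℤ.- q) c)
        ≡⟨ shift-inverse′ q c v ⟩
      c ∎)
      where
      q : ℤ
      q = charge c

    fromConfig-toConfig : ∀ x → fromConfig (toConfig x) ≡ x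
    fromConfig-toConfig (ν , d) =
      cong₂ _,_ (trans (cong (from partition↔balanced) rebalanced) (from-to partition↔balanced ν))
                (charge-toConfig ν d)
      where
      rebalanced : rebalance (toConfig (ν , d)) ≡ to partition↔balanced ν
      rebalanced = Σ-≡-irrelevant balanced-irrelevant
        (trans (cong (λ q → shift (ℤ.- q) (shift d (config₀ ν))) (charge-toConfig ν d))
               (shift-inverse d (config₀ ν) (config₀-valid ν)))

module Progression (C B : ℕ) .{{_ : NonZero C}} where

  open import Data.Nat using (suc; _+_; _*_; _>_)
  open import Data.Nat.Properties using (*-cancelˡ-<; *-cancelˡ-≡; *-monoʳ-<; +-cancelʳ-<; +-cancelʳ-≡; +-monoˡ-<)
  open import Data.Nat.ListAction using (sum)
  open import Data.Nat.Tactic.RingSolver using (solve-∀)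
  open import Data.List using (List; []; _∷_; map; length)
  open import Data.List.Relation.Unary.All as All using (All; []; _∷_)
  open import Data.List.Relation.Unary.Linked as Linked using (Linked)
  open import Data.List.Relation.Unary.Linked.Properties using (map⁺; map⁻)
  open import Function.Bundles using (_↔_; mk↔ₛ′)
  open import Relation.Nullary using (Irrelevant)
  open Bijections using (Σ-≡-irrelevant; ×-irrelevant)
  open StrictLists

  term : ℕ → ℕ
  term j = C * j + B

  term-mono : ∀ {i j} → i > j → term i > term j
  term-mono i>j = +-monoˡ-< B (*-monoʳ-< C i>j)

  term-reflect : ∀ {i j} → term i > term j → i > j
  term-reflect {i} {j} p = *-cancelˡ-< C j i (+-cancelʳ-< B _ _ p)

  term-injective : ∀ {i j} → term i ≡ term j → i ≡ j
  term-injective {i} {j} p = *-cancelˡ-≡ i j C (+-cancelʳ-≡ B _ _ p)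

  sum-map-term : ∀ X → sum (map term X) ≡ C * sum X + B * length X
  sum-map-term []       = zeros C B
    where
    zeros : ∀ c b → 0 ≡ c * 0 + b * 0
    zeros = solve-∀
  sum-map-term (x ∷ xs) = begin
    C * x + B + sum (map term xs)                ≡⟨ cong (C * x + B +_) (sum-map-term xs) ⟩
    C * x + B + (C * sum xs + B * length xs)     ≡⟨ rearrange C B x (sum xs) (length xs) ⟩
    C * (x + sum xs) + B * suc (length xs)       ∎
    where
    open ≡-Reasoning
    rearrange : ∀ c b x s l → c * x + b + (c * s + b * l) ≡ c * (x + s) + b * suc l
    rearrange = solve-∀

  module Image (R : ℕ → Set) (R-irrelevant : ∀ n → Irrelevant (R n))
               (R-term : ∀ j → R (term j))
               (R-index : ∀ n → R n → Σ ℕ λ j → term j ≡ n) where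

    StrictIn : List ℕ → Set
    StrictIn L = Strict L × All R L

    index : (L : List ℕ) → All R L → List ℕ
    index []      []       = []
    index (n ∷ L) (r ∷ rs) = proj₁ (R-index n r) ∷ index L rs

    map-index : ∀ L rs → map term (index L rs) ≡ L
    map-index []      []       = refl
    map-index (n ∷ L) (r ∷ rs) = cong₂ _∷_ (proj₂ (R-index n r)) (map-index L rs)

    index-map : ∀ X rs → index (map term X) rs ≡ X
    index-map []       []       = refl
    index-map (x ∷ xs) (r ∷ rs) = cong₂ _∷_ (term-injective (proj₂ (R-index (term x) r))) (index-map xs rs)

    R-map-term : ∀ X → All R (map term X)
    R-map-term []       = []
    R-map-term (x ∷ xs) = R-term x ∷ R-map-term xs

    index-strict : ∀ L rs → Strict L → Strict (index L rs)
    index-strict L rs sL = Linked.map term-reflect (map⁻ (subst Strict (sym (map-index L rs)) sL))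

    strict↔strictIn : StrictList ↔ Σ (List ℕ) StrictIn
    strict↔strictIn = mk↔ₛ′
      (λ { (X , sX) → map term X , map⁺ (Linked.map term-mono sX) , R-map-term X })
      (λ { (L , sL , rs) → index L rs , index-strict L rs sL })
      (λ { (L , sL , rs) → Σ-≡-irrelevant (λ L → ×-irrelevant (strict-irrelevant L) (All.irrelevant (R-irrelevant _)))
                                          (map-index L rs) })
      (λ { (X , sX) → Σ-≡-irrelevant strict-irrelevant (index-map X (R-map-term X)) })

module Copies where

  open import Data.Nat.Properties using (*-cancelʳ-≡; ≡-irrelevant; ≤-irrelevant)
  import Data.Nat.Divisibility as ℕ
  import Data.List.Relation.Unary.All as All
  open import Relation.Nullary using (Irrelevant)
  open Bijections using (×-irrelevant)
  open StrictLists using (strict-irrelevant)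

  inCopy-irrelevant : ∀ C .{{_ : NonZero C}} a n → Irrelevant (InCopy C a n)
  inCopy-irrelevant C a n = ×-irrelevant ≤-irrelevant ∣-irrelevant
    where
    ∣-irrelevant : ∀ {m} → Irrelevant (C ℕ.∣ m)
    ∣-irrelevant (ℕ.divides q e) (ℕ.divides q′ e′) with *-cancelʳ-≡ q q′ C (trans (sym e) e′)
    ... | refl = cong (ℕ.divides q) (≡-irrelevant e e′)

  distinctSubset-irrelevant : ∀ C .{{_ : NonZero C}} a L → Irrelevant (DistinctSubset C a L)
  distinctSubset-irrelevant C a L =
    ×-irrelevant (strict-irrelevant L) (All.irrelevant (inCopy-irrelevant C a _))

-- The positive integers ≡ a (mod C) form the progression B, C + B, …
-- where B is the least positive integer ≡ a (mod C).
module ResidueClass (C B : ℕ) .{{_ : NonZero C}} (a : ℤ.ℤ)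
                    (1≤B : 1 ≤ B) (B≤C : B ≤ C) (C∣B-a : ℤ.+ C Signed.∣ ℤ.+ B ℤ.- a) where

  open import Data.Nat using (suc; _+_; _*_; _<_; s≤s)
  open import Data.Nat.Properties using (+-monoˡ-≤; <⇒≱; m≤n*m; m≤n+m; ≤-trans)
  open import Data.Integer using (+_)
  import Data.Integer.Properties as ℤ
  open import Data.Integer.Tactic.RingSolver using (solve-∀)
  open import Relation.Nullary using (contradiction)
  open import Data.List using (List)
  open import Function.Bundles using (_↔_)
  open StrictLists using (StrictList)
  open ≡-Reasoning

  term-inCopy : ∀ j → InCopy C a (C * j + B)
  term-inCopy j =
    ≤-trans 1≤B (m≤n+m B (C * j)) ,
    Signed.∣⇒∣ᵤ (subst (+ C Signed.∣_) (sym regroup) (Signed.∣m∣n⇒∣m+n C∣Cj C∣B-a))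
    where
    C∣Cj : + C Signed.∣ + (C * j)
    C∣Cj = Signed.divides (+ j) (trans (ℤ.pos-* C j) (ℤ.*-comm (+ C) (+ j)))
    regroup : + (C * j + B) ℤ.- a ≡ + (C * j) ℤ.+ (+ B ℤ.- a)
    regroup = ℤ.+-assoc (+ (C * j)) (+ B) (ℤ.- a)

  -- Every element n of the class is a term: n - B is a multiple of C, and
  -- a negative multiple would force n ≤ B - C ≤ 0.
  inCopy-term : ∀ n → InCopy C a n → Σ ℕ λ j → C * j + B ≡ n
  inCopy-term n (1≤n , C∣n-a) = byQuotient (Signed.quotient C∣n-B) (Signed._∣_.equality C∣n-B)
    where
    cancel : ∀ n b a → n ℤ.- a ℤ.- (b ℤ.- a) ≡ n ℤ.- b
    cancel = solve-∀
    C∣n-B : + C Signed.∣ + n ℤ.- + B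
    C∣n-B = subst (+ C Signed.∣_) (cancel (+ n) (+ B) a)
                  (Signed.∣m∣n⇒∣m-n (Signed.∣ᵤ⇒∣ {i = + n ℤ.- a} C∣n-a) C∣B-a)
    move : ∀ n b q → n ℤ.- b ≡ q → n ≡ q ℤ.+ b
    move n b q eq = trans (sym (restore n b)) (cong (ℤ._+ b) eq)
      where
      restore : ∀ n b → n ℤ.- b ℤ.+ b ≡ n
      restore = solve-∀
    byQuotient : ∀ k → + n ℤ.- + B ≡ k ℤ.* + C → Σ ℕ λ j → C * j + B ≡ n
    byQuotient (+ j) eq = j , ℤ.+-injective (begin
      + (C * j) ℤ.+ + B   ≡⟨ cong (ℤ._+ + B) (trans (ℤ.pos-* C j) (ℤ.*-comm (+ C) (+ j))) ⟩
      + j ℤ.* + C ℤ.+ + B ≡⟨ move (+ n) (+ B) _ eq ⟨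
      + n                 ∎)
    byQuotient ℤ.-[1+ m ] eq = contradiction B≤C (<⇒≱ C<B)
      where
      cancelMultiple : ∀ k c b → ℤ.- k ℤ.* c ℤ.+ b ℤ.+ k ℤ.* c ≡ b
      cancelMultiple = solve-∀
      n+mC≡B : + n ℤ.+ + (suc m * C) ≡ + B
      n+mC≡B = trans (cong₂ ℤ._+_ (move (+ n) (+ B) _ eq) (ℤ.pos-* (suc m) C))
                     (cancelMultiple (+ suc m) (+ C) (+ B))
      C<B : C < B
      C<B = subst (C <_) (ℤ.+-injective n+mC≡B)
                  (≤-trans (s≤s (m≤n*m C (suc m))) (+-monoˡ-≤ (suc m * C) 1≤n))

  subsets↔ : StrictList ↔ Σ (List ℕ) (DistinctSubset C a)
  subsets↔ = Progression.Image.strict↔strictIn C B (InCopy C a) (Copies.inCopy-irrelevant C a) term-inCopy inCopy-term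

module Colours where

  open import Data.Nat using (zero; suc; _+_; _*_; _∸_; _≤_; _<_; s≤s; z≤n; >-nonZero⁻¹)
  open import Data.Nat.Properties
    using (+-identityʳ; <-≤-trans; <⇒≤; m<m+n; m<n⇒0<n∸m; m∸n+n≡m; m∸n≤m; m≤m+n; ≤-refl; ≤-trans)
  open import Data.Nat.ListAction using (sum)
  open import Data.Nat.Tactic.RingSolver using (solve-∀)
  open import Data.Integer as ℤ using (ℤ; +_)
  import Data.Integer.Properties as ℤ
  open import Data.Bool using (Bool; false)
  open import Data.List using (List; length; map)
  open import Data.List.Properties using (length-map)
  open import Data.Unit using (⊤; tt)
  open import Data.Product.Function.NonDependent.Propositional using (_×-↔_)
  open import Function.Bundles using (_↔_; mk↔ₛ′)
  open import Function.Properties.Inverse using (↔-refl; ↔-trans)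
  import Data.Bool.Properties as Bool
  open import Axiom.UniquenessOfIdentityProofs using (module Decidable⇒UIP)
  open import Relation.Nullary using (Irrelevant)
  open Bijections using (to; ×-irrelevant)
  open StrictLists
  open MayaDiagrams
  open JacobiTripleProduct using (ValidConfig)
  open ≡-Reasoning

  -- What one index i of the theorem contributes: a flag, which may only be
  -- set when A = 0, and the parts taken from the classes A and -A mod C.
  Colour : Set
  Colour = Bool × (List ℕ × List ℕ)

  FlagAllowed : ℕ → Bool → Set
  FlagAllowed zero    _ = ⊤
  FlagAllowed (suc _) b = b ≡ false

  Parts : ℕ → ℕ → List ℕ × List ℕ → Set
  Parts C A Ls = DistinctSubset C (+ A) (proj₁ Ls) × DistinctSubset C (ℤ.- (+ A)) (proj₂ Ls)

  IsColour : ℕ → ℕ → Colour → Set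
  IsColour C A y = FlagAllowed A (proj₁ y) × Parts C A (proj₂ y)

  flag-irrelevant : ∀ A b → Irrelevant (FlagAllowed A b)
  flag-irrelevant zero    _ _ _ = refl
  flag-irrelevant (suc _) _     = Decidable⇒UIP.≡-irrelevant Bool._≟_

  parts-irrelevant : ∀ C .{{_ : NonZero C}} A Ls → Irrelevant (Parts C A Ls)
  parts-irrelevant C A (L₁ , L₂) =
    ×-irrelevant (Copies.distinctSubset-irrelevant C (+ A) L₁) (Copies.distinctSubset-irrelevant C (ℤ.- (+ A)) L₂)

  colour-irrelevant : ∀ C .{{_ : NonZero C}} A y → Irrelevant (IsColour C A y)
  colour-irrelevant C A (b , Ls) = ×-irrelevant (flag-irrelevant A b) (parts-irrelevant C A Ls)

  partsSum : Colour → ℕ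
  partsSum (_ , L₁ , L₂) = sum L₁ + sum L₂

  partsCount : Colour → ℕ
  partsCount (b , L₁ , L₂) = length L₁ + length L₂ + bit b

  config↔pair : ValidConfig ↔ (StrictList × StrictList)
  config↔pair = mk↔ₛ′ (λ { ((P , Q) , (sP , sQ)) → (P , sP) , (Q , sQ) })
                      (λ { ((P , sP) , (Q , sQ)) → (P , Q) , (sP , sQ) })
                      (λ _ → refl) (λ _ → refl)

  module _ (C : ℕ) .{{_ : NonZero C}} where

    -- The least positive elements of the classes 0, A > 0 and -A mod C are
    -- C, A and C - A respectively.
    zeroClass↔ : StrictList ↔ Σ (List ℕ) (DistinctSubset C (+ 0))
    zeroClass↔ = ResidueClass.subsets↔ C C (+ 0) (>-nonZero⁻¹ C) ≤-refl
                   (Signed.∣-reflexive (sym (ℤ.+-identityʳ (+ C))))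

    posClass↔ : ∀ a → suc a ≤ C → StrictList ↔ Σ (List ℕ) (DistinctSubset C (+ suc a))
    posClass↔ a A≤C = ResidueClass.subsets↔ C (suc a) (+ suc a) (s≤s z≤n) A≤C
                        (Signed.divides (+ 0) (ℤ.+-inverseʳ (+ suc a)))

    negClass↔ : ∀ A → A < C → StrictList ↔ Σ (List ℕ) (DistinctSubset C (ℤ.- (+ A)))
    negClass↔ A A<C = ResidueClass.subsets↔ C (C ∸ A) (ℤ.- (+ A)) (m<n⇒0<n∸m A<C) (m∸n≤m C A)
                        (Signed.∣-reflexive C≡C-A+A)
      where
      C≡C-A+A : + C ≡ + (C ∸ A) ℤ.- ℤ.- (+ A)
      C≡C-A+A = trans (cong +_ (sym (m∸n+n≡m (<⇒≤ A<C))))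
                      (cong (λ x → + (C ∸ A) ℤ.+ x) (sym (ℤ.neg-involutive (+ A))))

    -- Per index: configurations ↔ admissible colours.  For A = 0 the
    -- particle at ½ (if any) is turned into the flag, since 0 is not a
    -- positive element of the class 0 mod C.
    colour↔ : ∀ A → 2 * A ≤ C → ValidConfig ↔ Σ Colour (IsColour C A)
    colour↔ zero    _   =
      ↔-trans config↔pair (↔-trans (lowering ×-↔ ↔-refl)
                          (↔-trans ((↔-refl ×-↔ zeroClass↔) ×-↔ negClass↔ 0 (>-nonZero⁻¹ C)) pack))
      where
      pack : ((Bool × Σ (List ℕ) (DistinctSubset C (+ 0))) × Σ (List ℕ) (DistinctSubset C (ℤ.- (+ 0))))
             ↔ Σ Colour (IsColour C 0)
      pack = mk↔ₛ′ (λ { ((b , L₁ , d₁) , (L₂ , d₂)) → (b , L₁ , L₂) , tt , d₁ , d₂ })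
                   (λ { ((b , L₁ , L₂) , _ , d₁ , d₂) → (b , L₁ , d₁) , (L₂ , d₂) })
                   (λ _ → refl) (λ _ → refl)
    colour↔ (suc a) 2A≤C =
      ↔-trans config↔pair (↔-trans (posClass↔ a (<⇒≤ A<C) ×-↔ negClass↔ (suc a) A<C) pack)
      where
      A<C : suc a < C
      A<C = <-≤-trans (m<m+n (suc a) (s≤s z≤n)) 2A≤C
      pack : (Σ (List ℕ) (DistinctSubset C (+ suc a)) × Σ (List ℕ) (DistinctSubset C (ℤ.- (+ suc a))))
             ↔ Σ Colour (IsColour C (suc a))
      pack = mk↔ₛ′ (λ { ((L₁ , d₁) , (L₂ , d₂)) → (false , L₁ , L₂) , refl , d₁ , d₂ })
                   (λ { ((b , L₁ , L₂) , _ , d₁ , d₂) → (L₁ , d₁) , (L₂ , d₂) })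
                   (λ { ((b , L₁ , L₂) , refl , d₁ , d₂) → refl })
                   (λ _ → refl)

    -- The parts of the colour of a configuration c have total
    -- C · energy c + A · charge c, written without subtraction ...
    colour-sum : ∀ A h x → let c = proj₁ x in
      partsSum (proj₁ (to (colour↔ A h) x)) + A * holes c ≡ C * energy c + A * particles c
    colour-sum zero _ ((P , Q) , (sP , sQ)) = begin
      sum (map term P′) + sum (map term Q) + 0 * length Q
        ≡⟨ cong₂ (λ u v → u + v + 0 * length Q)
                 (Progression.sum-map-term C C P′) (Progression.sum-map-term C C Q) ⟩
      C * sum P′ + C * length P′ + (C * sum Q + C * length Q) + 0 * length Q
        ≡⟨ rearrange C (sum P′) (length P′) (sum Q) (length Q) (length P) ⟩
      C * (sum P′ + length P′ + sum Q + length Q) + 0 * length P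
        ≡⟨ cong (λ s → C * (s + sum Q + length Q) + 0 * length P) (sum-lowerAll P sP) ⟨
      C * (sum P + sum Q + length Q) + 0 * length P ∎
      where
      term : ℕ → ℕ
      term = Progression.term C C
      P′ : List ℕ
      P′ = proj₁ (lowerAll P)
      rearrange : ∀ c s l t m n → c * s + c * l + (c * t + c * m) + 0 * m ≡ c * (s + l + t + m) + 0 * n
      rearrange = solve-∀
    colour-sum (suc a) h ((P , Q) , (sP , sQ)) = begin
      sum (map term₁ P) + sum (map term₂ Q) + A * length Q
        ≡⟨ cong₂ (λ u v → u + v + A * length Q) (Progression.sum-map-term C A P) (Progression.sum-map-term C B Q) ⟩
      C * sum P + A * length P + (C * sum Q + B * length Q) + A * length Q
        ≡⟨ rearrange C A B (sum P) (length P) (sum Q) (length Q) (m∸n+n≡m A≤C) ⟩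
      C * (sum P + sum Q + length Q) + A * length P ∎
      where
      A : ℕ
      A = suc a
      B : ℕ
      B = C ∸ A
      A≤C : A ≤ C
      A≤C = ≤-trans (m≤m+n A (A + 0)) h
      term₁ : ℕ → ℕ
      term₁ = Progression.term C A
      term₂ : ℕ → ℕ
      term₂ = Progression.term C B
      rearrange : ∀ c a b s l t m → b + a ≡ c →
        c * s + a * l + (c * t + b * m) + a * m ≡ c * (s + t + m) + a * l
      rearrange _ a b s l t m refl = identity a b s l t m
        where
        identity : ∀ a b s l t m → (b + a) * s + a * l + ((b + a) * t + b * m) + a * m ≡
                                   (b + a) * (s + t + m) + a * l
        identity = solve-∀

    colour-count : ∀ A h x → partsCount (proj₁ (to (colour↔ A h) x)) ≡ particles (proj₁ x) + holes (proj₁ x)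
    colour-count zero _ ((P , Q) , (sP , sQ)) = begin
      length (map term P′) + length (map term Q) + bit z
        ≡⟨ cong₂ (λ u v → u + v + bit z) (length-map term P′) (length-map term Q) ⟩
      length P′ + length Q + bit z
        ≡⟨ swap (length P′) (length Q) (bit z) ⟩
      length P′ + bit z + length Q
        ≡⟨ cong (_+ length Q) (length-lowerAll P sP) ⟨
      length P + length Q ∎
      where
      term : ℕ → ℕ
      term = Progression.term C C
      P′ : List ℕ
      P′ = proj₁ (lowerAll P)
      z : Bool
      z = proj₂ (lowerAll P)
      swap : ∀ a b c → a + b + c ≡ a + c + b
      swap = solve-∀
    colour-count (suc a) h ((P , Q) , (sP , sQ)) = begin
      length (map term₁ P) + length (map term₂ Q) + 0
        ≡⟨ +-identityʳ _ ⟩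
      length (map term₁ P) + length (map term₂ Q)
        ≡⟨ cong₂ _+_ (length-map term₁ P) (length-map term₂ Q) ⟩
      length P + length Q ∎
      where
      term₁ : ℕ → ℕ
      term₁ = Progression.term C (suc a)
      term₂ : ℕ → ℕ
      term₂ = Progression.term C (C ∸ suc a)

module FinIndexed where

  open import Data.Nat using (zero; suc; _+_; _≤_)
  open import Data.Nat.Properties using (m≤m+n; m≤n+m; ≤-trans)
  import Data.Nat.Tactic.RingSolver as ℕ-Solver
  open import Data.Integer as ℤ using (ℤ; +_)
  import Data.Integer.Tactic.RingSolver as ℤ-Solver
  open import Data.Fin using (Fin; zero; suc)
  open import Data.Vec using (Vec; []; _∷_; lookup)
  open import Data.Unit using (tt)
  open import Function.Bundles using (_↔_; mk↔ₛ′)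
  open import Relation.Nullary using (Dec; yes; Irrelevant)
  open import Relation.Nullary.Decidable using (_×-dec_)
  open Bijections

  sumFinℕ-cong : ∀ t {f g : Fin t → ℕ} → (∀ i → f i ≡ g i) → sumFinℕ t f ≡ sumFinℕ t g
  sumFinℕ-cong zero    f≡g = refl
  sumFinℕ-cong (suc t) f≡g = cong₂ _+_ (f≡g zero) (sumFinℕ-cong t (λ i → f≡g (suc i)))

  sumFinℤ-cong : ∀ t {f g : Fin t → ℤ} → (∀ i → f i ≡ g i) → sumFinℤ t f ≡ sumFinℤ t g
  sumFinℤ-cong zero    f≡g = refl
  sumFinℤ-cong (suc t) f≡g = cong₂ ℤ._+_ (f≡g zero) (sumFinℤ-cong t (λ i → f≡g (suc i)))

  sumFinℕ-+ : ∀ t (f g : Fin t → ℕ) → sumFinℕ t (λ i → f i + g i) ≡ sumFinℕ t f + sumFinℕ t g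
  sumFinℕ-+ zero    f g = refl
  sumFinℕ-+ (suc t) f g =
    trans (cong (λ s → f zero + g zero + s) (sumFinℕ-+ t (λ i → f (suc i)) (λ i → g (suc i))))
          (interchange (f zero) (g zero) _ _)
    where
    interchange : ∀ a b c d → a + b + (c + d) ≡ a + c + (b + d)
    interchange = ℕ-Solver.solve-∀

  sumFinℤ-+ : ∀ t (f g : Fin t → ℤ) → sumFinℤ t (λ i → f i ℤ.+ g i) ≡ sumFinℤ t f ℤ.+ sumFinℤ t g
  sumFinℤ-+ zero    f g = refl
  sumFinℤ-+ (suc t) f g =
    trans (cong (λ s → f zero ℤ.+ g zero ℤ.+ s) (sumFinℤ-+ t (λ i → f (suc i)) (λ i → g (suc i))))
          (interchange (f zero) (g zero) _ _)
    where
    interchange : ∀ a b c d → a ℤ.+ b ℤ.+ (c ℤ.+ d) ≡ a ℤ.+ c ℤ.+ (b ℤ.+ d)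
    interchange = ℤ-Solver.solve-∀

  sumFinℤ-pos : ∀ t (f : Fin t → ℕ) → sumFinℤ t (λ i → + f i) ≡ + sumFinℕ t f
  sumFinℤ-pos zero    f = refl
  sumFinℤ-pos (suc t) f = cong (λ s → + f zero ℤ.+ s) (sumFinℤ-pos t (λ i → f (suc i)))

  sumFinℕ-≥ : ∀ t (f : Fin t → ℕ) i → f i ≤ sumFinℕ t f
  sumFinℕ-≥ (suc t) f zero    = m≤m+n (f zero) _
  sumFinℕ-≥ (suc t) f (suc i) = ≤-trans (sumFinℕ-≥ t (λ j → f (suc j)) i) (m≤n+m _ (f zero))

  AllFin-lookup : ∀ t {P : Fin t → Set} → AllFin t P → ∀ i → P i
  AllFin-lookup (suc t) (p , _)  zero    = p
  AllFin-lookup (suc t) (_ , ps) (suc i) = AllFin-lookup t ps i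

  AllFin-tabulate : ∀ t {P : Fin t → Set} → (∀ i → P i) → AllFin t P
  AllFin-tabulate zero    f = tt
  AllFin-tabulate (suc t) f = f zero , AllFin-tabulate t (λ i → f (suc i))

  AllFin-map : ∀ t {P Q : Fin t → Set} → (∀ i → P i → Q i) → AllFin t P → AllFin t Q
  AllFin-map t f ps = AllFin-tabulate t (λ i → f i (AllFin-lookup t ps i))

  AllFin-irrelevant : ∀ t {P : Fin t → Set} → (∀ i → Irrelevant (P i)) → Irrelevant (AllFin t P)
  AllFin-irrelevant zero    irr tt       tt         = refl
  AllFin-irrelevant (suc t) irr (p , ps) (p′ , ps′) =
    cong₂ _,_ (irr zero p p′) (AllFin-irrelevant t (λ i → irr (suc i)) ps ps′)

  AllFin-dec : ∀ t {P : Fin t → Set} → (∀ i → Dec (P i)) → Dec (AllFin t P)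
  AllFin-dec zero    P? = yes tt
  AllFin-dec (suc t) P? = P? zero ×-dec AllFin-dec t (λ i → P? (suc i))

  AllFin-× : ∀ t (P Q : Fin t → Set) → AllFin t (λ i → P i × Q i) ↔ (AllFin t P × AllFin t Q)
  AllFin-× zero    P Q = mk↔ₛ′ (λ _ → tt , tt) (λ _ → tt) (λ { (tt , tt) → refl }) (λ { tt → refl })
  AllFin-× (suc t) P Q = mk↔ₛ′
    (λ { ((p , q) , r) → (p , proj₁ (to rest r)) , (q , proj₂ (to rest r)) })
    (λ { ((p , r) , (q , r′)) → (p , q) , from rest (r , r′) })
    (λ { ((p , r) , (q , r′)) → cong (λ z → (p , proj₁ z) , (q , proj₂ z)) (to-from rest (r , r′)) })
    (λ { ((p , q) , r) → cong ((p , q) ,_) (from-to rest r) })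
    where
    rest : AllFin t (λ i → P (suc i) × Q (suc i)) ↔ (AllFin t (λ i → P (suc i)) × AllFin t (λ i → Q (suc i)))
    rest = AllFin-× t (λ i → P (suc i)) (λ i → Q (suc i))

  vec↔ : ∀ {X Y : Set} t {V : Fin t → Y → Set} → (∀ i → X ↔ Σ Y (V i)) →
         Vec X t ↔ Σ (Vec Y t) (λ w → AllFin t (λ i → V i (lookup w i)))
  vec↔ zero    φ = mk↔ₛ′ (λ _ → [] , tt) (λ _ → []) (λ { ([] , tt) → refl }) (λ { [] → refl })
  vec↔ {X} {Y} (suc t) {V} φ = mk↔ₛ′ f g f∘g g∘f
    where
    rest : Vec X t ↔ Σ (Vec Y t) (λ w → AllFin t (λ i → V (suc i) (lookup w i)))
    rest = vec↔ t {λ i → V (suc i)} (λ i → φ (suc i))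
    f : Vec X (suc t) → Σ (Vec Y (suc t)) (λ w → AllFin (suc t) (λ i → V i (lookup w i)))
    f (x ∷ v) = (proj₁ (to (φ zero) x) ∷ proj₁ (to rest v)) , (proj₂ (to (φ zero) x) , proj₂ (to rest v))
    g : Σ (Vec Y (suc t)) (λ w → AllFin (suc t) (λ i → V i (lookup w i))) → Vec X (suc t)
    g ((y ∷ w) , (a , as)) = from (φ zero) (y , a) ∷ from rest (w , as)
    f∘g : ∀ z → f (g z) ≡ z
    f∘g ((y ∷ w) , (a , as)) = cons (to-from (φ zero) (y , a)) (to-from rest (w , as))
      where
      cons : ∀ {p p′ q q′} → p ≡ p′ → q ≡ q′ →
             _≡_ {A = Σ (Vec Y (suc t)) (λ w → AllFin (suc t) (λ i → V i (lookup w i)))}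
                 ((proj₁ p ∷ proj₁ q) , (proj₂ p , proj₂ q)) ((proj₁ p′ ∷ proj₁ q′) , (proj₂ p′ , proj₂ q′))
      cons refl refl = refl
    g∘f : ∀ v → g (f v) ≡ v
    g∘f (x ∷ v) = cong₂ _∷_ (from-to (φ zero) x) (from-to rest v)

  lookup-vec↔ : ∀ {X Y : Set} t {V : Fin t → Y → Set} (φ : ∀ i → X ↔ Σ Y (V i)) v i →
                lookup (proj₁ (to (vec↔ t φ) v)) i ≡ proj₁ (to (φ i) (lookup v i))
  lookup-vec↔ (suc t) φ (x ∷ v) zero    = refl
  lookup-vec↔ (suc t) φ (x ∷ v) (suc i) = lookup-vec↔ t (λ i → φ (suc i)) v i

  finite-Vec : ∀ {X : Set} t → Finite X → Finite (Vec X t)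
  finite-Vec zero    _   = finite-↔ (mk↔ₛ′ (λ _ → tt) (λ _ → []) (λ _ → refl) (λ { [] → refl })) finite-⊤
  finite-Vec {X} (suc t) fin = finite-↔ uncons (finite-× fin (finite-Vec t fin))
    where
    uncons : Vec X (suc t) ↔ (X × Vec X t)
    uncons = mk↔ₛ′ (λ { (x ∷ v) → x , v }) (λ { (x , v) → x ∷ v }) (λ _ → refl) (λ { (x ∷ v) → refl })

module Parities where

  open import Data.Nat using (zero; suc; _+_; _%_; parity)
  open import Data.Nat.Properties using (+-comm; +-suc; +-identityʳ)
  open import Data.Nat.DivMod using ([m+n]%n≡m%n)
  open import Data.Integer as ℤ using (ℤ; +_; _⊖_; ∣_∣)
  import Data.Integer.Properties as ℤ
  open import Data.Integer.Tactic.RingSolver using (solve-∀)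
  open import Data.Parity.Base as ℙ using (Parity; 0ℙ; 1ℙ)
  open ≡-Reasoning

  parityBit : Parity → ℕ
  parityBit 0ℙ = 0
  parityBit 1ℙ = 1

  %2≡parityBit : ∀ n → n % 2 ≡ parityBit (parity n)
  %2≡parityBit zero          = refl
  %2≡parityBit (suc zero)    = refl
  %2≡parityBit (suc (suc n)) = trans (trans (cong (_% 2) (+-comm 2 n)) ([m+n]%n≡m%n n 2)) (%2≡parityBit n)

  odd⇒parity : ∀ n → n % 2 ≡ 1 → parity n ≡ 1ℙ
  odd⇒parity n n%2≡1 with parity n | %2≡parityBit n
  ... | 1ℙ | _ = refl
  ... | 0ℙ | e with trans (sym n%2≡1) e
  ... | ()

  parity⇒odd : ∀ n → parity n ≡ 1ℙ → n % 2 ≡ 1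
  parity⇒odd n p≡1 = trans (%2≡parityBit n) (cong parityBit p≡1)

  parity-⊖ : ∀ a b → parity ∣ a ⊖ b ∣ ≡ parity (a + b)
  parity-⊖ zero    zero    = refl
  parity-⊖ zero    (suc b) = refl
  parity-⊖ (suc a) zero    = cong parity (sym (+-identityʳ (suc a)))
  parity-⊖ (suc a) (suc b) = begin
    parity ∣ suc a ⊖ suc b ∣   ≡⟨ cong (λ z → parity ∣ z ∣) (ℤ.[1+m]⊖[1+n]≡m⊖n a b) ⟩
    parity ∣ a ⊖ b ∣           ≡⟨ parity-⊖ a b ⟩
    parity (a + b)             ≡⟨ cong (λ n → parity (suc n)) (+-suc a b) ⟨
    parity (suc a + suc b)     ∎

  parity-difference : ∀ a b z → + a ≡ + b ℤ.+ z → parity ∣ z ∣ ≡ parity (a + b)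
  parity-difference a b z a≡b+z = trans (cong (λ w → parity ∣ w ∣) z≡a⊖b) (parity-⊖ a b)
    where
    isolate : ∀ b z → z ≡ b ℤ.+ z ℤ.- b
    isolate = solve-∀
    z≡a⊖b : z ≡ a ⊖ b
    z≡a⊖b = trans (isolate (+ b) z) (trans (cong (ℤ._- + b) (sym a≡b+z)) (ℤ.m-n≡m⊖n a b))

  parity-move : ∀ x n p → x ℙ.+ n ≡ p → n ≡ x ℙ.+ p
  parity-move 0ℙ n  p    e    = e
  parity-move 1ℙ 0ℙ .1ℙ refl = refl
  parity-move 1ℙ 1ℙ .0ℙ refl = refl

  parity-move⁻ : ∀ x n p → n ≡ x ℙ.+ p → x ℙ.+ n ≡ p
  parity-move⁻ 0ℙ n p    e    = e
  parity-move⁻ 1ℙ _ 0ℙ   refl = refl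
  parity-move⁻ 1ℙ _ 1ℙ   refl = refl

module FlagVectors where

  open import Data.Nat using (zero; suc; _+_; _∸_; _^_; parity)
  open import Data.Nat.Properties using (+-identityʳ; suc-injective; ≡-irrelevant)
  open import Data.Parity.Base as ℙ using (Parity; 0ℙ; 1ℙ; _⁻¹)
  import Data.Parity.Properties as ℙ
  open import Data.Bool using (Bool; true; false)
  open import Data.Fin using (Fin; zero; suc)
  open import Data.Fin.Properties using (+↔⊎)
  open import Data.Vec using (Vec; []; _∷_; lookup)
  open import Data.Sum using (_⊎_; inj₁; inj₂)
  open import Data.Sum.Function.Propositional using (_⊎-↔_)
  open import Data.Unit using (⊤; tt)
  open import Function.Bundles using (_↔_; mk↔ₛ′)
  open import Function.Properties.Inverse using (↔-refl; ↔-trans; ↔-sym)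
  open import Relation.Nullary using (Irrelevant)
  open import Axiom.UniquenessOfIdentityProofs using (module Decidable⇒UIP)
  open StrictLists using (bit)
  open Colours using (FlagAllowed)
  open Parities

  Flags : (t : ℕ) → (Fin t → ℕ) → Parity → Set
  Flags t A p = Σ (Vec Bool t) λ bs →
    AllFin t (λ i → FlagAllowed (A i) (lookup bs i)) × parity (sumFinℕ t (λ i → bit (lookup bs i))) ≡ p

  parity-irrelevant : ∀ {p q : Parity} → Irrelevant (p ≡ q)
  parity-irrelevant = Decidable⇒UIP.≡-irrelevant ℙ._≟_

  flags-suc : ∀ t A p → Flags (suc t) A p ↔
    Σ Bool (λ b → FlagAllowed (A zero) b × Flags t (λ i → A (suc i)) (parity (bit b) ℙ.+ p))
  flags-suc t A p = mk↔ₛ′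
    (λ { ((b ∷ bs) , (ok , oks) , e) →
         b , ok , bs , oks , parity-move (parity (bit b)) _ p (trans (sym (ℙ.+-homo-+ (bit b) _)) e) })
    (λ { (b , ok , bs , oks , e) →
         (b ∷ bs) , (ok , oks) , trans (ℙ.+-homo-+ (bit b) _) (parity-move⁻ (parity (bit b)) _ p e) })
    (λ { (b , ok , bs , oks , e) → cong (λ e → b , ok , bs , oks , e) (parity-irrelevant _ _) })
    (λ { ((b ∷ bs) , oks , e) → cong (λ e → (b ∷ bs) , oks , e) (parity-irrelevant _ _) })

  forcedFlag : ∀ {Q : Bool → Set} → Σ Bool (λ b → (b ≡ false) × Q b) ↔ Q false
  forcedFlag = mk↔ₛ′ (λ { (false , refl , q) → q }) (λ q → false , refl , q)
                     (λ _ → refl) (λ { (false , refl , q) → refl })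

  freeFlag : ∀ {Q : Bool → Set} → Σ Bool (λ b → ⊤ × Q b) ↔ (Q false ⊎ Q true)
  freeFlag = mk↔ₛ′ (λ { (false , tt , q) → inj₁ q ; (true , tt , q) → inj₂ q })
                   (λ { (inj₁ q) → false , tt , q ; (inj₂ q) → true , tt , q })
                   (λ { (inj₁ _) → refl ; (inj₂ _) → refl })
                   (λ { (false , tt , q) → refl ; (true , tt , q) → refl })

  addIfZero : ℕ → ℕ → ℕ
  addIfZero zero    n = suc n
  addIfZero (suc _) n = n

  countZeros-suc : ∀ t A → countZeros (suc t) A ≡ addIfZero (A zero) (countZeros t (λ i → A (suc i)))
  countZeros-suc t A with A zero
  ... | zero  = refl
  ... | suc _ = refl

  flags-noZero : ∀ t A p → countZeros t A ≡ 0 → Flags t A p ↔ (0ℙ ≡ p)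
  flags-noZero zero    A p _ = mk↔ₛ′ (λ { ([] , tt , e) → e }) (λ e → [] , tt , e)
                                     (λ _ → refl) (λ { ([] , tt , e) → refl })
  flags-noZero (suc t) A p none = ↔-trans (flags-suc t A p) (byFirst (A zero) (trans (sym (countZeros-suc t A)) none))
    where
    byFirst : ∀ a → addIfZero a (countZeros t (λ i → A (suc i))) ≡ 0 →
              Σ Bool (λ b → FlagAllowed a b × Flags t (λ i → A (suc i)) (parity (bit b) ℙ.+ p)) ↔ (0ℙ ≡ p)
    byFirst (suc _) rest = ↔-trans forcedFlag (flags-noZero t (λ i → A (suc i)) p rest)

  oneParity : ∀ p → ((0ℙ ≡ p) ⊎ (0ℙ ≡ p ⁻¹)) ↔ Fin 1
  oneParity p = mk↔ₛ′ (λ _ → zero) (λ _ → theOne p) (λ { zero → refl }) (unique p)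
    where
    theOne : ∀ p → (0ℙ ≡ p) ⊎ (0ℙ ≡ p ⁻¹)
    theOne 0ℙ = inj₁ refl
    theOne 1ℙ = inj₂ refl
    unique : ∀ p x → theOne p ≡ x
    unique 0ℙ (inj₁ refl) = refl
    unique 1ℙ (inj₂ refl) = refl

  Fin-cong : ∀ {m n} → m ≡ n → Fin m ↔ Fin n
  Fin-cong refl = ↔-refl

  flags-someZero : ∀ t A p r → countZeros t A ≡ suc r → Flags t A p ↔ Fin (2 ^ r)
  flags-someZero (suc t) A p r some = ↔-trans (flags-suc t A p) (byFirst (A zero) r (trans (sym (countZeros-suc t A)) some))
    where
    A′ : Fin t → ℕ
    A′ = λ i → A (suc i)
    byFirst : ∀ a r → addIfZero a (countZeros t A′) ≡ suc r →
              Σ Bool (λ b → FlagAllowed a b × Flags t A′ (parity (bit b) ℙ.+ p)) ↔ Fin (2 ^ r)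
    byFirst (suc _) r rest = ↔-trans forcedFlag (flags-someZero t A′ p r rest)
    byFirst zero zero rest = ↔-trans freeFlag
      (↔-trans (flags-noZero t A′ p (suc-injective rest) ⊎-↔ flags-noZero t A′ (p ⁻¹) (suc-injective rest))
               (oneParity p))
    byFirst zero (suc r) rest = ↔-trans freeFlag
      (↔-trans (flags-someZero t A′ p r (suc-injective rest) ⊎-↔ flags-someZero t A′ (p ⁻¹) r (suc-injective rest))
      (↔-trans (↔-sym +↔⊎) (Fin-cong (cong (2 ^ r +_) (sym (+-identityʳ (2 ^ r)))))))

  oddCompletions : ∀ t A k →
    Flags t A (parity k ℙ.+ 1ℙ) ↔ (Fin (2 ^ (countZeros t A ∸ 1)) × ParityOK (countZeros t A) k)
  oddCompletions t A k = byCount (countZeros t A) refl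
    where
    byCount : ∀ z → countZeros t A ≡ z → Flags t A (parity k ℙ.+ 1ℙ) ↔ (Fin (2 ^ (z ∸ 1)) × ParityOK z k)
    byCount zero    none = ↔-trans (flags-noZero t A _ none) (mk↔ₛ′
      (λ e → zero , parity⇒odd k (even⁻¹ (parity k) e))
      (λ { (_ , odd) → odd⁻¹ (parity k) (odd⇒parity k odd) })
      (λ { (zero , _) → cong (zero ,_) (≡-irrelevant _ _) })
      (λ _ → parity-irrelevant _ _))
      where
      even⁻¹ : ∀ p → 0ℙ ≡ p ℙ.+ 1ℙ → p ≡ 1ℙ
      even⁻¹ 1ℙ _ = refl
      odd⁻¹ : ∀ p → p ≡ 1ℙ → 0ℙ ≡ p ℙ.+ 1ℙ
      odd⁻¹ 1ℙ _ = refl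
    byCount (suc r) some = ↔-trans (flags-someZero t A _ r some) (mk↔ₛ′ (_, tt) proj₁ (λ _ → refl) (λ _ → refl))

module PairColours (C A : ℕ) .{{_ : NonZero C}} (2A≤C : 2 * A ≤ C) where

  open import Data.Nat as ℕ using (_+_)
  open import Data.Integer as ℤ using (ℤ; +_)
  import Data.Integer.Properties as ℤ
  open import Data.Integer.Tactic.RingSolver using (solve-∀)
  open import Function.Bundles using (_↔_)
  open import Function.Properties.Inverse using (↔-trans)
  open Bijections using (to)
  open MayaDiagrams
  open JacobiTripleProduct
  open Colours
  open ≡-Reasoning

  pair↔colour : (Partition × ℤ) ↔ Σ Colour (IsColour C A)
  pair↔colour = ↔-trans jacobi (colour↔ C A 2A≤C)

  colourOf : Partition × ℤ → Colour
  colourOf x = proj₁ (to pair↔colour x)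

  particlesOf holesOf : Partition × ℤ → ℕ
  particlesOf x = particles (proj₁ (to jacobi x))
  holesOf     x = holes (proj₁ (to jacobi x))

  count-colourOf : ∀ x → partsCount (colourOf x) ≡ particlesOf x + holesOf x
  count-colourOf x = colour-count C A 2A≤C (to jacobi x)

  charge-colourOf : ∀ ν d → + particlesOf (ν , d) ≡ + holesOf (ν , d) ℤ.+ d
  charge-colourOf ν d = solveFor (+ particlesOf (ν , d)) (+ holesOf (ν , d)) d (charge-toConfig ν d)
    where
    solveFor : ∀ p q d → p ℤ.- q ≡ d → p ≡ q ℤ.+ d
    solveFor p q d p-q≡d = trans (regroup p q) (cong (λ x → q ℤ.+ x) p-q≡d)
      where
      regroup : ∀ p q → p ≡ q ℤ.+ (p ℤ.- q)
      regroup = solve-∀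

  sum-colourOf : ∀ ν d →
    + C ℤ.* + size ν ℤ.+ + C ℤ.* binom2 d ℤ.+ + A ℤ.* d ≡ + partsSum (colourOf (ν , d))
  sum-colourOf ν d = begin
    + C ℤ.* + size ν ℤ.+ + C ℤ.* binom2 d ℤ.+ + A ℤ.* d
      ≡⟨ factor (+ C) (+ size ν) (binom2 d) (+ A ℤ.* d) ⟩
    + C ℤ.* (+ size ν ℤ.+ binom2 d) ℤ.+ + A ℤ.* d
      ≡⟨ cong₂ (λ e q → + C ℤ.* e ℤ.+ + A ℤ.* q) (energy-toConfig ν d) (charge-toConfig ν d) ⟨
    + C ℤ.* + E ℤ.+ + A ℤ.* (+ p ℤ.- + q)
      ≡⟨ solveFor (+ S) (+ A) (+ q) (+ C) (+ E) (+ p) lifted ⟩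
    + S ∎
    where
    c : Config
    c = proj₁ (to jacobi (ν , d))
    E : ℕ
    E = energy c
    p : ℕ
    p = particles c
    q : ℕ
    q = holes c
    S : ℕ
    S = partsSum (colourOf (ν , d))
    factor : ∀ c s b r → c ℤ.* s ℤ.+ c ℤ.* b ℤ.+ r ≡ c ℤ.* (s ℤ.+ b) ℤ.+ r
    factor = solve-∀
    lifted : + S ℤ.+ + A ℤ.* + q ≡ + C ℤ.* + E ℤ.+ + A ℤ.* + p
    lifted = begin
      + S ℤ.+ + A ℤ.* + q          ≡⟨ cong (λ x → + S ℤ.+ x) (ℤ.pos-* A q) ⟨
      + (S + A ℕ.* q)              ≡⟨ cong +_ (colour-sum C A 2A≤C (to jacobi (ν , d))) ⟩
      + (C ℕ.* E + A ℕ.* p)        ≡⟨ cong₂ ℤ._+_ (ℤ.pos-* C E) (ℤ.pos-* A p) ⟩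
      + C ℤ.* + E ℤ.+ + A ℤ.* + p  ∎
    solveFor : ∀ s a q c e p → s ℤ.+ a ℤ.* q ≡ c ℤ.* e ℤ.+ a ℤ.* p → c ℤ.* e ℤ.+ a ℤ.* (p ℤ.- q) ≡ s
    solveFor s a q c e p h = begin
      c ℤ.* e ℤ.+ a ℤ.* (p ℤ.- q)      ≡⟨ expand c e a p q ⟩
      c ℤ.* e ℤ.+ a ℤ.* p ℤ.- a ℤ.* q  ≡⟨ cong (ℤ._- a ℤ.* q) h ⟨
      s ℤ.+ a ℤ.* q ℤ.- a ℤ.* q        ≡⟨ cancel s (a ℤ.* q) ⟩
      s                                ∎
      where
      expand : ∀ c e a p q → c ℤ.* e ℤ.+ a ℤ.* (p ℤ.- q) ≡ c ℤ.* e ℤ.+ a ℤ.* p ℤ.- a ℤ.* q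
      expand = solve-∀
      cancel : ∀ s x → s ℤ.+ x ℤ.- x ≡ s
      cancel = solve-∀

module Counting (t : ℕ) (C A : Fin t → ℕ) (hC : ∀ i → 1 ≤ C i) (hA : ∀ i → 2 * A i ≤ C i) (N : ℕ) where

  open import Data.Nat using (_+_; _∸_; _^_; parity; >-nonZero)
  open import Data.Nat.Properties using (≡-irrelevant)
  open import Data.Nat.ListAction using (sum)
  open import Data.Integer as ℤ using (ℤ; +_; ∣_∣)
  import Data.Integer.Properties as ℤ
  open import Data.Parity.Base as ℙ using (1ℙ)
  import Data.Parity.Properties as ℙ
  open import Data.Bool using (Bool)
  open import Data.Vec using (Vec; lookup; zip)
  open import Data.Vec.Properties using (lookup-zip; ×v↔v×)
  open import Data.List using (List; length)
  open import Data.Product.Function.Dependent.Propositional using (Σ-↔)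
  open import Data.Product.Function.NonDependent.Propositional using (_×-↔_)
  open import Function.Bundles using (_↔_; mk↔ₛ′)
  open import Function.Properties.Inverse using (↔-refl; ↔-sym; ↔-trans)
  open import Relation.Nullary using (Irrelevant)
  open import Axiom.UniquenessOfIdentityProofs using (module Decidable⇒UIP)
  open Bijections
  open StrictLists using (bit)
  open Colours
  open FinIndexed
  open Parities
  open FlagVectors
  open ≡-Reasoning

  module Pair (i : Fin t) = PairColours (C i) (A i) {{>-nonZero (hC i)}} (hA i)

  IsColourAt : Fin t → Colour → Set
  IsColourAt i = IsColour (C i) (A i)

  AllColours : Vec Colour t → Set
  AllColours w = AllFin t (λ i → IsColourAt i (lookup w i))

  colours↔ : Vec (Partition × ℤ) t ↔ Σ (Vec Colour t) AllColours
  colours↔ = vec↔ t Pair.pair↔colour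

  TupleCondition : Vec (Partition × ℤ) t → Set
  TupleCondition v = OddZ (sumFinℤ t (λ i → proj₂ (lookup v i)))
    × (sumFinℤ t (λ i → (+ C i) ℤ.* (+ size (proj₁ (lookup v i))))
       ℤ.+ sumFinℤ t (λ i → (+ C i) ℤ.* binom2 (proj₂ (lookup v i)))
       ℤ.+ sumFinℤ t (λ i → (+ A i) ℤ.* proj₂ (lookup v i))) ≡ + N

  ColourCondition : Vec Colour t → Set
  ColourCondition w = parity (sumFinℕ t (λ i → partsCount (lookup w i))) ≡ 1ℙ
                    × sumFinℕ t (λ i → partsSum (lookup w i)) ≡ N

  module Transfer (v : Vec (Partition × ℤ) t) where

    w : Vec Colour t
    w = proj₁ (to colours↔ v)

    lookup-w : ∀ i → lookup w i ≡ Pair.colourOf i (lookup v i)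
    lookup-w i = lookup-vec↔ t Pair.pair↔colour v i

    Σp Σq : ℕ
    Σp = sumFinℕ t (λ i → Pair.particlesOf i (lookup v i))
    Σq = sumFinℕ t (λ i → Pair.holesOf i (lookup v i))
    Σd : ℤ
    Σd = sumFinℤ t (λ i → proj₂ (lookup v i))

    count-total : sumFinℕ t (λ i → partsCount (lookup w i)) ≡ Σp + Σq
    count-total = trans (sumFinℕ-cong t (λ i → trans (cong partsCount (lookup-w i)) (Pair.count-colourOf i (lookup v i))))
                        (sumFinℕ-+ t _ _)

    charge-total : + Σp ≡ + Σq ℤ.+ Σd
    charge-total = begin
      + Σp                                                         ≡⟨ sumFinℤ-pos t _ ⟨
      sumFinℤ t (λ i → + Pair.particlesOf i (lookup v i))
        ≡⟨ sumFinℤ-cong t (λ i → Pair.charge-colourOf i (proj₁ (lookup v i)) (proj₂ (lookup v i))) ⟩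
      sumFinℤ t (λ i → + Pair.holesOf i (lookup v i) ℤ.+ proj₂ (lookup v i)) ≡⟨ sumFinℤ-+ t _ _ ⟩
      sumFinℤ t (λ i → + Pair.holesOf i (lookup v i)) ℤ.+ Σd        ≡⟨ cong (ℤ._+ Σd) (sumFinℤ-pos t _) ⟩
      + Σq ℤ.+ Σd                                                  ∎

    parity-total : parity ∣ Σd ∣ ≡ parity (sumFinℕ t (λ i → partsCount (lookup w i)))
    parity-total = trans (parity-difference Σp Σq Σd charge-total) (cong parity (sym count-total))

    weight-total : sumFinℤ t (λ i → (+ C i) ℤ.* (+ size (proj₁ (lookup v i))))
                   ℤ.+ sumFinℤ t (λ i → (+ C i) ℤ.* binom2 (proj₂ (lookup v i)))
                   ℤ.+ sumFinℤ t (λ i → (+ A i) ℤ.* proj₂ (lookup v i))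
                   ≡ + sumFinℕ t (λ i → partsSum (lookup w i))
    weight-total = begin
      _ ≡⟨ cong (ℤ._+ sumFinℤ t (λ i → (+ A i) ℤ.* proj₂ (lookup v i))) (sumFinℤ-+ t _ _) ⟨
      _ ≡⟨ sumFinℤ-+ t _ _ ⟨
      _ ≡⟨ sumFinℤ-cong t (λ i → trans (Pair.sum-colourOf i (proj₁ (lookup v i)) (proj₂ (lookup v i)))
                                       (cong (λ y → + partsSum y) (sym (lookup-w i)))) ⟩
      _ ≡⟨ sumFinℤ-pos t (λ i → partsSum (lookup w i)) ⟩
      _ ∎

    tuple⇒colour : TupleCondition v → ColourCondition w
    tuple⇒colour (odd , weight) =
      trans (sym parity-total) (odd⇒parity ∣ Σd ∣ odd) , ℤ.+-injective (trans (sym weight-total) weight)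

    colour⇒tuple : ColourCondition w → TupleCondition v
    colour⇒tuple (odd , total) = parity⇒odd ∣ Σd ∣ (trans parity-total odd) , trans weight-total (cong +_ total)

  tupleCondition-irrelevant : ∀ v → Irrelevant (TupleCondition v)
  tupleCondition-irrelevant v = ×-irrelevant ≡-irrelevant (Decidable⇒UIP.≡-irrelevant ℤ._≟_)

  colourCondition-irrelevant : ∀ w → Irrelevant (ColourCondition w)
  colourCondition-irrelevant w = ×-irrelevant parity-irrelevant ≡-irrelevant

  tuples↔colours : Tuples t C A N ↔ Σ (Vec Colour t) (λ w → AllColours w × ColourCondition w)
  tuples↔colours =
    ↔-trans (Σ-cong-irrelevant Transfer.tuple⇒colour Transfer.colour⇒tuple tupleCondition-irrelevant
                               (λ v → colourCondition-irrelevant (Transfer.w v)))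
    (↔-trans (Σ-↔ {B = λ u → ColourCondition (proj₁ u)} colours↔ ↔-refl)
             (mk↔ₛ′ (λ { ((w , ok) , cc) → w , ok , cc }) (λ { (w , ok , cc) → (w , ok) , cc })
                    (λ _ → refl) (λ _ → refl)))

  ΣK ΣE : Vec (List ℕ × List ℕ) t → ℕ
  ΣK ls = sumFinℕ t (λ i → length (proj₁ (lookup ls i)) + length (proj₂ (lookup ls i)))
  ΣE ls = sumFinℕ t (λ i → sum (proj₁ (lookup ls i)) + sum (proj₂ (lookup ls i)))

  ΣB : Vec Bool t → ℕ
  ΣB bs = sumFinℕ t (λ i → bit (lookup bs i))

  AllParts : Vec (List ℕ × List ℕ) t → Set
  AllParts ls = AllFin t (λ i → Parts (C i) (A i) (lookup ls i))

  AllFlags : Vec Bool t → Set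
  AllFlags bs = AllFin t (λ i → FlagAllowed (A i) (lookup bs i))

  SplitCondition : Vec Bool t × Vec (List ℕ × List ℕ) t → Set
  SplitCondition (bs , ls) = (AllFlags bs × AllParts ls) × (parity (ΣK ls + ΣB bs) ≡ 1ℙ × ΣE ls ≡ N)

  module Unzipped (bs : Vec Bool t) (ls : Vec (List ℕ × List ℕ) t) where

    lookup-zipped : ∀ i → lookup (zip bs ls) i ≡ (lookup bs i , lookup ls i)
    lookup-zipped i = lookup-zip i bs ls

    count : sumFinℕ t (λ i → partsCount (lookup (zip bs ls) i)) ≡ ΣK ls + ΣB bs
    count = trans (sumFinℕ-cong t (λ i → cong partsCount (lookup-zipped i))) (sumFinℕ-+ t _ _)

    total : sumFinℕ t (λ i → partsSum (lookup (zip bs ls) i)) ≡ ΣE ls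
    total = sumFinℕ-cong t (λ i → cong partsSum (lookup-zipped i))

    zipped⇒split : AllColours (zip bs ls) × ColourCondition (zip bs ls) → SplitCondition (bs , ls)
    zipped⇒split (ok , odd , e) =
      to (AllFin-× t _ _) (AllFin-map t (λ i → subst (IsColourAt i) (lookup-zipped i)) ok) ,
      trans (cong parity (sym count)) odd , trans (sym total) e

    split⇒zipped : SplitCondition (bs , ls) → AllColours (zip bs ls) × ColourCondition (zip bs ls)
    split⇒zipped (oks , odd , e) =
      AllFin-map t (λ i → subst (IsColourAt i) (sym (lookup-zipped i))) (from (AllFin-× t _ _) oks) ,
      trans (cong parity count) odd , trans total e

  splitCondition-irrelevant : ∀ p → Irrelevant (SplitCondition p)
  splitCondition-irrelevant (bs , ls) =
    ×-irrelevant (×-irrelevant (AllFin-irrelevant t (λ i → flag-irrelevant (A i) _))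
                               (AllFin-irrelevant t (λ i → parts-irrelevant (C i) {{>-nonZero (hC i)}} (A i) _)))
                 (×-irrelevant parity-irrelevant ≡-irrelevant)

  colours↔split : Σ (Vec Colour t) (λ w → AllColours w × ColourCondition w) ↔
                  Σ (Vec Bool t × Vec (List ℕ × List ℕ) t) SplitCondition
  colours↔split = ↔-trans (↔-sym (Σ-↔ ×v↔v× ↔-refl))
    (Σ-cong-irrelevant (λ { (bs , ls) → Unzipped.zipped⇒split bs ls })
                       (λ { (bs , ls) → Unzipped.split⇒zipped bs ls })
                       (λ { (bs , ls) → ×-irrelevant (AllFin-irrelevant t (λ i → colour-irrelevant′ i _))
                                                      (colourCondition-irrelevant (zip bs ls)) })
                       splitCondition-irrelevant)
    where
    colour-irrelevant′ : ∀ i y → Irrelevant (IsColourAt i y)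
    colour-irrelevant′ i = colour-irrelevant (C i) {{>-nonZero (hC i)}} (A i)

  split↔flags : Σ (Vec Bool t × Vec (List ℕ × List ℕ) t) SplitCondition ↔
                Σ (Vec (List ℕ × List ℕ) t) (λ ls → (AllParts ls × ΣE ls ≡ N) × Flags t A (parity (ΣK ls) ℙ.+ 1ℙ))
  split↔flags = mk↔ₛ′
    (λ { ((bs , ls) , (fl , ps) , odd , e) →
         ls , (ps , e) , bs , fl , parity-move (parity (ΣK ls)) _ 1ℙ (trans (sym (ℙ.+-homo-+ (ΣK ls) (ΣB bs))) odd) })
    (λ { (ls , (ps , e) , bs , fl , p) →
         (bs , ls) , (fl , ps) , trans (ℙ.+-homo-+ (ΣK ls) (ΣB bs)) (parity-move⁻ (parity (ΣK ls)) _ 1ℙ p) , e })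
    (λ { (ls , (ps , e) , bs , fl , p) → cong (λ p → ls , (ps , e) , bs , fl , p) (parity-irrelevant _ _) })
    (λ { ((bs , ls) , oks , odd , e) → cong (λ odd → (bs , ls) , oks , odd , e) (parity-irrelevant _ _) })

  R : ℕ
  R = 2 ^ (countZeros t A ∸ 1)

  flags↔distPart : Σ (Vec (List ℕ × List ℕ) t) (λ ls → (AllParts ls × ΣE ls ≡ N) × Flags t A (parity (ΣK ls) ℙ.+ 1ℙ)) ↔
                   (Fin R × DistPart t C A N)
  flags↔distPart = ↔-trans (Σ-↔ ↔-refl (λ {ls} → ↔-refl ×-↔ oddCompletions t A (ΣK ls)))
    (mk↔ₛ′ (λ { (ls , (ps , e) , r , po) → r , ls , ps , e , po })
           (λ { (r , ls , ps , e , po) → ls , (ps , e) , r , po })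
           (λ _ → refl) (λ _ → refl))

  tuples↔distPart : Tuples t C A N ↔ (Fin R × DistPart t C A N)
  tuples↔distPart = ↔-trans tuples↔colours (↔-trans colours↔split (↔-trans split↔flags flags↔distPart))

-- DistPart is finite: every part is at most N, and finite subsets of
-- {0, …, N} form a finite type.
module FiniteDistPart where

  open import Data.Nat as ℕ using (zero; suc; _+_; _<_; _<?_; _≤?_; z<s; s≤s; >-nonZero)
  open import Data.Nat.Properties using (≤-trans; ≤-reflexive; m≤m+n; m≤n+m; <-irrelevant; ≡-irrelevant; _≟_)
  open import Data.Fin.Properties using (2↔Bool)
  open import Data.Nat.ListAction using (sum)
  import Data.Nat.Divisibility as ℕ
  open import Data.Integer as ℤ using (+_; ∣_∣)
  open import Data.Bool using (Bool; true; false)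
  open import Data.List using (List; []; _∷_; length)
  open import Data.List.Relation.Unary.All as All using (All; []; _∷_)
  open import Data.List.Relation.Unary.Linked as Linked using (Linked; [])
  open import Data.Vec using (Vec; lookup)
  open import Data.Unit using (tt)
  open import Data.Product.Function.Dependent.Propositional using (Σ-↔)
  open import Function.Bundles using (_↔_; mk↔ₛ′)
  open import Function.Properties.Inverse using (↔-refl; ↔-sym; ↔-trans)
  open import Relation.Nullary using (Dec; yes; Irrelevant)
  open import Relation.Nullary.Decidable using (_×-dec_)
  open Bijections
  open StrictLists
  open FinIndexed

  Below : ℕ → List ℕ → Set
  Below b L = Strict L × All (_< b) L

  below-irrelevant : ∀ b L → Irrelevant (Below b L)
  below-irrelevant b L = ×-irrelevant (strict-irrelevant L) (All.irrelevant <-irrelevant)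

  lowerAll-below : ∀ {b} L → All (_< suc b) L → All (_< b) (proj₁ (lowerAll L))
  lowerAll-below []           _                = []
  lowerAll-below (zero ∷ _)   _                = []
  lowerAll-below (suc x ∷ xs) (s≤s x<b ∷ rest) = x<b ∷ lowerAll-below xs rest

  raiseAll-below : ∀ {b} L z → All (_< b) L → All (_< suc b) (raiseAll L z)
  raiseAll-below []       false _            = []
  raiseAll-below []       true  _            = z<s ∷ []
  raiseAll-below (x ∷ xs) z     (x<b ∷ rest) = s≤s x<b ∷ raiseAll-below xs z rest

  -- Lowering identifies subsets of {0, …, b} with a flag and a subset of
  -- {0, …, b - 1}; hence there are 2^(b+1) of them.
  finite-below : ∀ b → Finite (Σ (List ℕ) (Below b))
  finite-below zero    = finite-↔ (mk↔ₛ′ (λ _ → tt) (λ _ → [] , [] , []) (λ _ → refl) onlyEmpty) finite-⊤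
    where
    onlyEmpty : ∀ x → ([] , [] , []) ≡ x
    onlyEmpty ([]    , [] , [])      = refl
    onlyEmpty ((_ ∷ _) , _ , (() ∷ _))
  finite-below (suc b) = finite-↔ lowering-below (finite-× (2 , ↔-sym 2↔Bool) (finite-below b))
    where
    lowering-below : Σ (List ℕ) (Below (suc b)) ↔ (Bool × Σ (List ℕ) (Below b))
    lowering-below = mk↔ₛ′
      (λ { (L , sL , bL) → proj₂ (lowerAll L) , proj₁ (lowerAll L) , lowerAll-strict L sL , lowerAll-below L bL })
      (λ { (z , L , sL , bL) → raiseAll L z , raiseAll-strict L z sL , raiseAll-below L z bL })
      (λ { (z , L , _) → let e = lowerAll-raiseAll L z in
                         cong₂ _,_ (cong proj₂ e) (Σ-≡-irrelevant (below-irrelevant b) (cong proj₁ e)) })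
      (λ { (L , sL , _) → Σ-≡-irrelevant (below-irrelevant (suc b)) (raiseAll-lowerAll L sL) })

  elements≤sum : ∀ L → All (_≤ sum L) L
  elements≤sum []       = []
  elements≤sum (x ∷ xs) =
    m≤m+n x (sum xs) ∷ All.map (λ y≤ → ≤-trans y≤ (m≤n+m (sum xs) x)) (elements≤sum xs)

  inCopy-dec : ∀ C a n → Dec (InCopy C a n)
  inCopy-dec C a n = (1 ≤? n) ×-dec (C ℕ.∣? ∣ + n ℤ.- a ∣)

  distinctSubset-dec : ∀ C a L → Dec (DistinctSubset C a L)
  distinctSubset-dec C a L = Linked.linked? (λ x y → y <? x) L ×-dec All.all? (inCopy-dec C a) L

  parityOK-dec : ∀ z k → Dec (ParityOK z k)
  parityOK-dec zero    k = k ℕ.% 2 ≟ 1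
  parityOK-dec (suc _) k = yes tt

  parityOK-irrelevant : ∀ z k → Irrelevant (ParityOK z k)
  parityOK-irrelevant zero    k = ≡-irrelevant
  parityOK-irrelevant (suc _) k _ _ = refl

  module _ (t : ℕ) (C A : Fin t → ℕ) (hC : ∀ i → 1 ≤ C i) (N : ℕ) where

    DistCondition : Vec (List ℕ × List ℕ) t → Set
    DistCondition v =
      AllFin t (λ i → DistinctSubset (C i) (+ A i) (proj₁ (lookup v i))
                    × DistinctSubset (C i) (ℤ.- (+ A i)) (proj₂ (lookup v i)))
      × sumFinℕ t (λ i → sum (proj₁ (lookup v i)) + sum (proj₂ (lookup v i))) ≡ N
      × ParityOK (countZeros t A)
                 (sumFinℕ t (λ i → length (proj₁ (lookup v i)) + length (proj₂ (lookup v i))))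

    distCondition-irrelevant : ∀ v → Irrelevant (DistCondition v)
    distCondition-irrelevant v =
      ×-irrelevant (AllFin-irrelevant t (λ i →
                      ×-irrelevant (Copies.distinctSubset-irrelevant (C i) {{>-nonZero (hC i)}} (+ A i) _)
                                   (Copies.distinctSubset-irrelevant (C i) {{>-nonZero (hC i)}} (ℤ.- (+ A i)) _)))
                   (×-irrelevant ≡-irrelevant (parityOK-irrelevant _ _))

    distCondition-dec : ∀ v → Dec (DistCondition v)
    distCondition-dec v =
      AllFin-dec t (λ i → distinctSubset-dec (C i) (+ A i) _ ×-dec distinctSubset-dec (C i) (ℤ.- (+ A i)) _)
      ×-dec ((_ ≟ N) ×-dec parityOK-dec _ _)

    BoundedPair : List ℕ × List ℕ → Set
    BoundedPair (L₁ , L₂) = Below (suc N) L₁ × Below (suc N) L₂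

    boundedPair-irrelevant : ∀ p → Irrelevant (BoundedPair p)
    boundedPair-irrelevant (L₁ , L₂) = ×-irrelevant (below-irrelevant (suc N) L₁) (below-irrelevant (suc N) L₂)

    bounded : ∀ v → DistCondition v → AllFin t (λ i → BoundedPair (lookup v i))
    bounded v (parts , total , _) = AllFin-tabulate t boundedAt
      where
      total≤N : ∀ i → sum (proj₁ (lookup v i)) + sum (proj₂ (lookup v i)) ≤ N
      total≤N i = ≤-trans (sumFinℕ-≥ t _ i) (≤-reflexive total)
      boundedAt : ∀ i → BoundedPair (lookup v i)
      boundedAt i =
        (proj₁ (proj₁ (AllFin-lookup t parts i)) ,
         All.map (λ x≤ → s≤s (≤-trans x≤ (≤-trans (m≤m+n _ _) (total≤N i)))) (elements≤sum _)) ,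
        (proj₁ (proj₂ (AllFin-lookup t parts i)) ,
         All.map (λ x≤ → s≤s (≤-trans x≤ (≤-trans (m≤n+m _ _) (total≤N i)))) (elements≤sum _))

    finite-DistPart : Finite (DistPart t C A N)
    finite-DistPart = finite-↔ (↔-trans addBounds (↔-trans regroup (↔-sym (Σ-↔ restrict ↔-refl))))
      (finite-Σ (finite-Vec t finite-boundedPairs)
                (λ u → finite-prop (distCondition-dec (proj₁ (to restrict u)))
                                   (distCondition-irrelevant (proj₁ (to restrict u)))))
      where
      AllBounded : Vec (List ℕ × List ℕ) t → Set
      AllBounded v = AllFin t (λ i → BoundedPair (lookup v i))
      restrict : Vec (Σ (List ℕ × List ℕ) BoundedPair) t ↔ Σ (Vec (List ℕ × List ℕ) t) AllBounded
      restrict = vec↔ t (λ _ → ↔-refl)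
      addBounds : DistPart t C A N ↔ Σ (Vec (List ℕ × List ℕ) t) (λ v → AllBounded v × DistCondition v)
      addBounds = Σ-cong-irrelevant (λ v c → bounded v c , c) (λ _ → proj₂) distCondition-irrelevant
        (λ v → ×-irrelevant (AllFin-irrelevant t (λ i → boundedPair-irrelevant _)) (distCondition-irrelevant v))
      regroup : Σ (Vec (List ℕ × List ℕ) t) (λ v → AllBounded v × DistCondition v) ↔
                Σ (Σ (Vec (List ℕ × List ℕ) t) AllBounded) (λ u → DistCondition (proj₁ u))
      regroup = mk↔ₛ′ (λ { (v , b , c) → (v , b) , c }) (λ { ((v , b) , c) → v , b , c })
                      (λ _ → refl) (λ _ → refl)
      finite-boundedPairs : Finite (Σ (List ℕ × List ℕ) BoundedPair)
      finite-boundedPairs = finite-↔ (mk↔ₛ′ (λ { ((L₁ , L₂) , (b₁ , b₂)) → (L₁ , b₁) , (L₂ , b₂) })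
                                            (λ { ((L₁ , b₁) , (L₂ , b₂)) → (L₁ , L₂) , (b₁ , b₂) })
                                            (λ _ → refl) (λ _ → refl))
                                     (finite-× (finite-below (suc N)) (finite-below (suc N)))

-- The theorem: m = |DistPart| and k = 2^r · m.
lemma2p2 : (t : ℕ) → 1 ≤ t → (C A : Fin t → ℕ) →
    (∀ i → 1 ≤ C i) → (∀ i → 2 * A i ≤ C i) →
    (N : ℕ) → 1 ≤ N →
    Σ ℕ λ m → Σ ℕ λ k →
      (DistPart t C A N ↔ Fin m) × (Tuples t C A N ↔ Fin k)
      × 2 ^ (countZeros t A ∸ 1) * m ≡ k
lemma2p2 t _ C A hC hA N _ = m , R * m , distPart↔m , tuples↔Rm , refl
  where
  open import Data.Fin.Properties using (*↔×)
  open import Data.Product.Function.NonDependent.Propositional using (_×-↔_)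
  open import Function.Properties.Inverse using (↔-refl; ↔-sym; ↔-trans)
  R : ℕ
  R = 2 ^ (countZeros t A ∸ 1)
  m : ℕ
  m = proj₁ (FiniteDistPart.finite-DistPart t C A hC N)
  distPart↔m : DistPart t C A N ↔ Fin m
  distPart↔m = proj₂ (FiniteDistPart.finite-DistPart t C A hC N)
  tuples↔Rm : Tuples t C A N ↔ Fin (R * m)
  tuples↔Rm = ↔-trans (Counting.tuples↔distPart t C A hC hA N)
                      (↔-trans (↔-refl ×-↔ distPart↔m) (↔-sym *↔×))
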